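{- Let $n,p$ be positive coprime integers and let $\omega\in\widetilde{\mathfrak S}_n$ be a dominant $p$-stable affine permutation. Then $t^p_{i,j}(\omega)=d_{i,j}(\mathcal A(\omega))$ for all $i,j\in[n]$ with $i<j$; that is, the rational Shi tableau of $\omega$ equals the codinv tableau of the rational Dyck path $\mathcal A(\omega)$.
   Context: Affine permutations: $\widetilde{\mathfrak S}_n$ is the group of bijections $\omega:\mathbb Z\to\mathbb Z$ with $\omega(i+n)=\omega(i)+n$ and $\omega(1)+\dots+\omega(n)=n(n+1)/2$. $\omega$ is dominant if $\omega^{ -1}(1)<\dots<\omega^{ -1}(n)$, and $p$-stable if $\omega(i)<\omega(i+p)$ for all $i$. For $i<j$ in $[n]$ let $k_{i,j}(\omega)=|\lfloor(\omega^{ -1}(j)-\omega^{ -1}(i))/n\rfloor|$; let $s\in\mathfrak S_n$ with $s(i)\equiv\omega^{ -1}(i)\pmod n$; write $p=mn+r$, $m\ge0$, $r\in[n-1]$ (when $n\ge 2$). The rational Shi tableau: $t^p_{i,j}(\omega)=\min(k_{i,j}(\omega),m)$ if $r+s(i)<s(j)$ or $s(i)+r-n<s(j)<s(i)$, and $\min(k_{i,j}(\omega),m+1)$ otherwise. Rational Dyck paths: a rational Dyck path is a lattice path from $(0,0)$ with $n$ North steps $(0,1)$ and $p$ East steps $(1,0)$ never going below the line of slope $n/p$ through the origin; $\mathfrak D_{n,p}$ is the set of these. The unit square with bottom-right corner $(i,j)$ gets label $\ell_{i,j}=jp-in$; each step of a path gets the label $\ell_{i,j}$ of its starting point $(i,j)$.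 Let $\ell_1<\ell_2<\dots<\ell_n$ be the labels of the North steps of $x$. Let $H(x)$ be the set of positive labels of unit squares lying below $x$ (i.e. between $x$ and the diagonal). The codinv tableau of $x$ is $d_{i,j}(x)=\#\{h\in H(x):\ell_i<h<\ell_i+p,\ h\equiv\ell_j \pmod n\}$ for $i<j$ in $[n]$. Anderson map: for a finite set $H$ of positive integers there is a unique partition whose first-column cells have hook lengths exactly $H$; let $\varphi(x)$ be the partition with first-column hook length set $H(x)$. By Anderson's theorem, $\varphi$ is a bijection from $\mathfrak D_{n,p}$ to the set of $n,p$-cores (partitions with no hook length equal to $n$ or $p$). For a partition $\kappa$ let $\alpha(\kappa)=\{\kappa_i+1-i:i\ge1\}$ (with $\kappa_i=0$ for $i>\ell(\kappa)$), and for dominant $\omega$ let $\gamma(\omega)=\{z\in\mathbb Z:\omega(z)\le0\}$. For dominant $p$-stable $\omega$ there is a unique $n,p$-core $\kappa$ with $\alpha(\kappa)=\gamma(\omega)$, and $\mathcal A(\omega)=\varphi^{ -1}(\kappa)$. -}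

module Defs where

open import Data.Bool using (Bool; true; false; _∨_; _∧_; if_then_else_)
open import Data.Nat as ℕ using (ℕ; zero; suc; NonZero; _∸_)
import Data.Nat.Properties as ℕP
open import Data.Integer as ℤ using (ℤ; +_; _-_; _/ℕ_; _%ℕ_; ∣_∣)
import Data.Integer.Properties as ℤP
open import Data.List using (List; []; _∷_; length; filter; map; upTo; drop; concatMap; sum; applyUpTo)
open import Data.Bool.ListAction using (any)
open import Data.List.Relation.Unary.All using (All)
open import Data.List.Relation.Unary.Linked using (Linked)
open import Data.Product using (Σ; _×_; ∃; _,_)
open import Relation.Nullary using (does; ¬_)
open import Relation.Binary.PropositionalEquality using (_≡_)
open import Function.Bundles using (_↔_; Inverse)
import Data.List.Sort.InsertionSort

module _ (ω : ℤ ↔ ℤ) where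
  open Inverse ω

  windowSum : ℕ → ℤ
  windowSum n = Data.List.foldr ℤ._+_ (+ 0) (applyUpTo (λ k → to (+ suc k)) n)

IsAffinePerm : (n : ℕ) → ℤ ↔ ℤ → Set
IsAffinePerm n ω =
  (∀ i → Inverse.to ω (i ℤ.+ + n) ≡ Inverse.to ω i ℤ.+ + n)
  × windowSum ω n ≡ + ((n ℕ.* suc n) ℕ./ 2)

Dominant : (n : ℕ) → ℤ ↔ ℤ → Set
Dominant n ω = ∀ a b → 1 ℕ.≤ a → a ℕ.< b → b ℕ.≤ n →
  Inverse.from ω (+ a) ℤ.< Inverse.from ω (+ b)

PStable : (p : ℕ) → ℤ ↔ ℤ → Set
PStable p ω = ∀ i → Inverse.to ω i ℤ.< Inverse.to ω (i ℤ.+ + p)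

module _ (n p : ℕ) .{{_ : NonZero n}} (ω : ℤ ↔ ℤ) where
  open Inverse ω

  kTab : ℕ → ℕ → ℕ
  kTab i j = ∣ (from (+ j) - from (+ i)) /ℕ n ∣

  sPerm : ℕ → ℕ
  sPerm i = suc ((from (+ i) - + 1) %ℕ n)

  mQ : ℕ
  mQ = p ℕ./ n

  rR : ℕ
  rR = p ℕ.% n

  shiTableau : ℕ → ℕ → ℕ
  shiTableau i j =
    if does (+ rR ℤ.+ + sPerm i ℤ.<? + sPerm j)
       ∨ (does (+ sPerm i ℤ.+ + rR - + n ℤ.<? + sPerm j)
          ∧ does (+ sPerm j ℤ.<? + sPerm i))
    then kTab i j ℕ.⊓ mQ
    else kTab i j ℕ.⊓ suc mQ

data Step : Set where
  N E : Step

count : Step → List Step → ℕ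
count s [] = 0
count N (N ∷ xs) = suc (count N xs)
count N (E ∷ xs) = count N xs
count E (E ∷ xs) = suc (count E xs)
count E (N ∷ xs) = count E xs

IsDyck : ℕ → ℕ → List Step → Set
IsDyck n p x =
  count N x ≡ n × count E x ≡ p ×
  (∀ k → count E (Data.List.take k x) ℕ.* n ℕ.≤ count N (Data.List.take k x) ℕ.* p)

module _ (n p : ℕ) where
  label : ℕ → ℕ → ℤ
  label i j = + (j ℕ.* p) - + (i ℕ.* n)

  northLabelsFrom : ℕ → ℕ → List Step → List ℤ
  northLabelsFrom i j [] = []
  northLabelsFrom i j (N ∷ xs) = label i j ∷ northLabelsFrom i (suc j) xs
  northLabelsFrom i j (E ∷ xs) = northLabelsFrom (suc i) j xs

  -- labels of all unit squares lying below x: an East step from (i , j) to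
  -- (suc i , j) has below it exactly the squares with bottom-right corner
  -- (suc i , j') for j' < j
  squaresBelowFrom : ℕ → ℕ → List Step → List ℤ
  squaresBelowFrom i j [] = []
  squaresBelowFrom i j (N ∷ xs) = squaresBelowFrom i (suc j) xs
  squaresBelowFrom i j (E ∷ xs) =
    applyUpTo (λ j' → label (suc i) j') j ++' squaresBelowFrom (suc i) j xs
    where
    _++'_ : List ℤ → List ℤ → List ℤ
    _++'_ = Data.List._++_

  inH : List Step → ℤ → Bool
  inH x h = does (+ 0 ℤ.<? h) ∧ any (λ l → does (l ℤ.≟ h)) (squaresBelowFrom 0 0 x)

open module ZSort = Data.List.Sort.InsertionSort ℤP.≤-decTotalOrder using (sort)

nth : {A : Set} → A → List A → ℕ → A
nth d [] k = d
nth d (a ∷ as) zero = a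
nth d (a ∷ as) (suc k) = nth d as k

module _ (n p : ℕ) .{{_ : NonZero n}} where
  ellN : List Step → ℕ → ℤ
  ellN x i = nth (+ 0) (sort (northLabelsFrom n p 0 0 x)) (i ∸ 1)

  codinv : List Step → ℕ → ℕ → ℕ
  codinv x i j =
    length (filter (λ h → Data.Bool.T? (inH n p x h ∧ does ((h - ellN x j) %ℕ n ℕ.≟ 0)))
                   (map (λ k → ellN x i ℤ.+ + k) (drop 1 (upTo p))))

IsPartition : List ℕ → Set
IsPartition κ = All (λ a → 0 ℕ.< a) κ × Linked ℕ._≥_ κ

-- κ_i for i ≥ 1 (0 beyond the length)
part : List ℕ → ℕ → ℕ
part κ i = nth 0 κ (i ∸ 1)

conjPart : List ℕ → ℕ → ℕ
conjPart κ j = length (filter (λ a → j ℕ.≤? a) κ)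

IsCell : List ℕ → ℕ → ℕ → Set
IsCell κ i j = 1 ℕ.≤ i × 1 ℕ.≤ j × j ℕ.≤ part κ i

hook : List ℕ → ℕ → ℕ → ℕ
hook κ i j = (part κ i ∸ j) ℕ.+ (conjPart κ j ∸ i) ℕ.+ 1

IsCore : ℕ → ℕ → List ℕ → Set
IsCore n p κ = ∀ i j → IsCell κ i j → ¬ (hook κ i j ≡ n) × ¬ (hook κ i j ≡ p)

FirstColHook : List ℕ → ℤ → Set
FirstColHook κ h = ∃ λ i → IsCell κ i 1 × h ≡ + hook κ i 1

InAlpha : List ℕ → ℤ → Set
InAlpha κ z = ∃ λ i → 1 ℕ.≤ i × z ≡ + (part κ i) ℤ.+ + 1 - + i

-- Write a t for ω⁻¹(t). Dominance together with α(κ) = {z : ω z ≤ 0} forces a 1 = 1 − ℓ(κ),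
-- so that H(x) = {h > 0 : ω (h + a 1) ≤ 0}. As gcd(n, p) = 1, lattice points in n consecutive
-- rows have distinct labels; this identifies the sorted North labels as ℓ_t = a t − a 1.
-- Put D = a j − a i = K n + ρ and p = m n + r. By periodicity ω (a i + k) = j + (k − D)
-- whenever k ≡ D (mod n), so d_{i,j} counts the k < min(p, D) with k ≡ ρ, which is K if
-- D ≤ p and m + [ρ < r] otherwise. On the Shi side s(j) ≡ s(i) + ρ (mod n), which turns
-- the defining condition into r < ρ, and k_{i,j} = K. The two values can only differ when
-- ρ = r and K > m, and p-stability excludes this: then ω (a i + p) ≤ 0 < ω (a i).

module Submission where

open import Defs
open import Data.Bool using (Bool; true; false; _∧_; _∨_; if_then_else_; T?)
open import Data.Bool.ListAction using (any)
import Data.Bool.Properties as BoolP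
open import Data.Empty using (⊥; ⊥-elim)
open import Data.Integer as ℤ using (ℤ; +_; +[1+_])
open import Data.Integer.DivMod using (a≡a%ℕn+[a/ℕn]*n; n%ℕd<d)
import Data.Integer.Properties as ℤP
open import Data.Integer.Tactic.RingSolver using (solve-∀)
open import Data.List using (List; []; _∷_; length; filter; map; applyUpTo; upTo; drop; _++_; take)
import Data.List.Properties as ListP
open import Data.List.Membership.Propositional using (_∈_)
open import Data.List.Membership.Propositional.Properties
  using (∈-map⁺; ∈-map⁻; ∈-++⁺ˡ; ∈-++⁺ʳ; ∈-++⁻; ∈-applyUpTo⁺; ∈-applyUpTo⁻)
open import Data.List.Relation.Binary.Permutation.Propositional using (↭⇒↭ₛ; ↭-sym)
import Data.List.Relation.Binary.Permutation.Propositional.Properties as PermutationP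
import Data.List.Relation.Binary.Permutation.Setoid.Properties as PermutationₛP
open import Data.List.Relation.Unary.All using (All; _∷_)
import Data.List.Relation.Unary.All as All
open import Data.List.Relation.Unary.AllPairs using (AllPairs; []; _∷_)
import Data.List.Relation.Unary.AllPairs as AllPairs
import Data.List.Relation.Unary.AllPairs.Properties as AllPairsP
open import Data.List.Relation.Unary.Any using (here; there)
open import Data.List.Relation.Unary.Linked.Properties using (Linked⇒AllPairs)
import Data.List.Sort.InsertionSort.Properties as InsertionSortP
open import Data.Nat as ℕ
  using (ℕ; zero; suc; _+_; _*_; _∸_; _⊓_; _≤_; _<_; z≤n; s≤s; NonZero; _≤?_; _<?_)
open import Data.Nat.Coprimality using (Coprime; coprime-divisor)
open import Data.Nat.Divisibility using (_∣_; divides; ∣⇒≤)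
open import Data.Nat.DivMod
  using (_%_; _/_; m≡m%n+[m/n]*n; m%n<n; m<n⇒m%n≡m; [m+kn]%n≡m%n; /-mono-≤)
import Data.Nat.Properties as ℕP
open import Data.Product using (∃; _×_; _,_; proj₁; proj₂)
open import Data.Sum using (_⊎_; inj₁; inj₂)
open import Function.Bundles using (_↔_; _⇔_; mk⇔; Inverse; Equivalence)
import Function.Properties.Equivalence as ⇔
open import Relation.Binary.Definitions using (Tri; tri<; tri≈; tri>)
open import Relation.Binary.PropositionalEquality
open import Relation.Nullary using (¬_; Dec; yes; no; does)
open import Relation.Nullary.Decidable using (dec-true; dec-false; does-⇔)
open import Relation.Unary using (Decidable)

-- Arithmetic

+-−-cross : ∀ a b c d → + a ℤ.- + b ≡ + c ℤ.- + d → a + d ≡ c + b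
+-−-cross a b c d e = ℤP.+-injective (begin
  + a ℤ.+ + d                      ≡⟨ shift (+ a) (+ b) (+ d) ⟩
  (+ a ℤ.- + b) ℤ.+ (+ b ℤ.+ + d)  ≡⟨ cong (ℤ._+ (+ b ℤ.+ + d)) e ⟩
  (+ c ℤ.- + d) ℤ.+ (+ b ℤ.+ + d)  ≡⟨ unshift (+ c) (+ b) (+ d) ⟩
  + c ℤ.+ + b                      ∎)
  where
  open ≡-Reasoning
  shift : ∀ a b d → a ℤ.+ d ≡ (a ℤ.- b) ℤ.+ (b ℤ.+ d)
  shift = solve-∀
  unshift : ∀ c b d → (c ℤ.- d) ℤ.+ (b ℤ.+ d) ≡ c ℤ.+ b
  unshift = solve-∀

ℤ-−+-cancel : ∀ a b → a ℤ.- b ℤ.+ b ≡ a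
ℤ-−+-cancel = solve-∀

ℤ-+−-cancel : ∀ a b → a ℤ.+ b ℤ.- b ≡ a
ℤ-+−-cancel = solve-∀

ℤ-+-cancelʳ-≡ : ∀ a b c → a ℤ.+ c ≡ b ℤ.+ c → a ≡ b
ℤ-+-cancelʳ-≡ a b c e = begin
  a                   ≡⟨ ℤ-+−-cancel a c ⟨
  (a ℤ.+ c) ℤ.- c     ≡⟨ cong (ℤ._- c) e ⟩
  (b ℤ.+ c) ℤ.- c     ≡⟨ ℤ-+−-cancel b c ⟩
  b                   ∎
  where open ≡-Reasoning

+≡+⇒−≡− : ∀ x b y c → x ℤ.+ b ≡ y ℤ.+ c → x ℤ.- c ≡ y ℤ.- b
+≡+⇒−≡− x b y c e = begin
  x ℤ.- c                  ≡⟨ regroup x b c ⟩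
  x ℤ.+ b ℤ.- c ℤ.- b      ≡⟨ cong (λ z → z ℤ.- c ℤ.- b) e ⟩
  y ℤ.+ c ℤ.- c ℤ.- b      ≡⟨ cong (ℤ._- b) (ℤ-+−-cancel y c) ⟩
  y ℤ.- b                  ∎
  where
  open ≡-Reasoning
  regroup : ∀ x b c → x ℤ.- c ≡ x ℤ.+ b ℤ.- c ℤ.- b
  regroup = solve-∀

0<x-y⇒y<x : ∀ x y → + 0 ℤ.< + x ℤ.- + y → y < x
0<x-y⇒y<x x y 0<x-y with y ℕ.<? x
... | yes y<x = y<x
... | no  y≮x = ⊥-elim (ℤP.<⇒≱ 0<x-y (ℤP.i≤j⇒i-j≤0 (ℤ.+≤+ (ℕP.≮⇒≥ y≮x))))

x-y<z⇔x<z+y : ∀ x y z → + x ℤ.- + y ℤ.< + z ⇔ x < z + y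
x-y<z⇔x<z+y x y z = mk⇔
  (λ lt → ℤP.drop‿+<+ (subst (ℤ._< + (z + y)) (ℤ-−+-cancel (+ x) (+ y)) (ℤP.+-monoˡ-< (+ y) lt)))
  (λ lt → subst (+ x ℤ.- + y ℤ.<_) (ℤ-+−-cancel (+ z) (+ y)) (ℤP.+-monoˡ-< (ℤ.- + y) (ℤ.+<+ lt)))

y+dn≡j⇒y≤0 : ∀ n d j y → 1 ≤ d → j ≤ n → y ℤ.+ + (d * n) ≡ + j → y ℤ.≤ + 0
y+dn≡j⇒y≤0 n (suc d) j y _ j≤n e = subst (ℤ._≤ + 0) y≡j-dn
  (ℤP.i≤j⇒i-j≤0 (ℤ.+≤+ (ℕP.≤-trans j≤n (ℕP.m≤m+n n (d * n)))))
  where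
  y≡j-dn : + j ℤ.- + (suc d * n) ≡ y
  y≡j-dn = sym (ℤ-+-cancelʳ-≡ y _ (+ (suc d * n)) (trans e (sym (ℤ-−+-cancel (+ j) (+ (suc d * n))))))

offset-multiple-<⇔ : ∀ n .{{_ : NonZero n}} ρ q K → ρ + q * n < ρ + K * n ⇔ q < K
offset-multiple-<⇔ n ρ q K = mk⇔ (λ lt → ℕP.*-cancelʳ-< n q K (ℕP.+-cancelˡ-< ρ _ _ lt))
                                 (λ q<K → ℕP.+-monoʳ-< ρ (ℕP.*-monoˡ-< n q<K))

offset-multiple-fill : ∀ n ρ q K → q ≤ K → ρ + q * n + (K ∸ q) * n ≡ ρ + K * n
offset-multiple-fill n ρ q K q≤K = begin
  ρ + q * n + (K ∸ q) * n     ≡⟨ ℕP.+-assoc ρ _ _ ⟩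
  ρ + (q * n + (K ∸ q) * n)   ≡⟨ cong (ρ ℕ.+_) (ℕP.*-distribʳ-+ n q (K ∸ q)) ⟨
  ρ + (q + (K ∸ q)) * n       ≡⟨ cong (λ c → ρ + c * n) (ℕP.m+[n∸m]≡n q≤K) ⟩
  ρ + K * n                   ∎
  where open ≡-Reasoning

module Residues (n : ℕ) .{{_ : NonZero n}} where

  small-difference-multiple⇒≡ : ∀ u v c → u < n → v < n → + u ℤ.- + v ≡ c ℤ.* + n → u ≡ v
  small-difference-multiple⇒≡ u v (+ zero) _ _ e = trans (sym (ℕP.+-identityʳ u)) (+-−-cross u v 0 0 e)
  small-difference-multiple⇒≡ u v +[1+ c ] u<n _ e = ⊥-elim (ℕP.<⇒≱ u<n (begin
    n                    ≤⟨ ℕP.m≤m+n n (c * n) ⟩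
    suc c * n            ≤⟨ ℕP.m≤m+n _ v ⟩
    suc c * n + v        ≡⟨ +-−-cross u v (suc c * n) 0 (trans e positive-multiple) ⟨
    u + 0                ≡⟨ ℕP.+-identityʳ u ⟩
    u                    ∎))
    where
    open ℕP.≤-Reasoning
    positive-multiple : +[1+ c ] ℤ.* + n ≡ + (suc c * n) ℤ.- + 0
    positive-multiple = trans (sym (ℤP.pos-* (suc c) n)) (sym (ℤP.+-identityʳ _))
  small-difference-multiple⇒≡ u v ℤ.-[1+ c ] _ v<n e = ⊥-elim (ℕP.<⇒≱ v<n (begin
    n                    ≤⟨ ℕP.m≤m+n n (c * n) ⟩
    suc c * n            ≤⟨ ℕP.m≤n+m _ u ⟩
    u + suc c * n        ≡⟨ +-−-cross u v 0 (suc c * n) (trans e negative-multiple) ⟩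
    v                    ∎))
    where
    open ℕP.≤-Reasoning
    negative-multiple : ℤ.-[1+ c ] ℤ.* + n ≡ + 0 ℤ.- + (suc c * n)
    negative-multiple = trans (sym (ℤP.neg-distribˡ-* +[1+ c ] (+ n)))
                              (trans (cong ℤ.-_ (sym (ℤP.pos-* (suc c) n))) (sym (ℤP.+-identityˡ _)))

  difference-of-multiples : ∀ u c v d m → u ℤ.+ c ℤ.* m ≡ v ℤ.+ d ℤ.* m → u ℤ.- v ≡ (d ℤ.- c) ℤ.* m
  difference-of-multiples u c v d m e = ℤ-+-cancelʳ-≡ _ _ (v ℤ.+ c ℤ.* m) (begin
    u ℤ.- v ℤ.+ (v ℤ.+ c ℤ.* m)           ≡⟨ regroupˡ u v c m ⟩
    u ℤ.+ c ℤ.* m                         ≡⟨ e ⟩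
    v ℤ.+ d ℤ.* m                         ≡⟨ regroupʳ v c d m ⟩
    (d ℤ.- c) ℤ.* m ℤ.+ (v ℤ.+ c ℤ.* m)   ∎)
    where
    open ≡-Reasoning
    regroupˡ : ∀ u v c m → u ℤ.- v ℤ.+ (v ℤ.+ c ℤ.* m) ≡ u ℤ.+ c ℤ.* m
    regroupˡ = solve-∀
    regroupʳ : ∀ v c d m → v ℤ.+ d ℤ.* m ≡ (d ℤ.- c) ℤ.* m ℤ.+ (v ℤ.+ c ℤ.* m)
    regroupʳ = solve-∀

  %ℕ-unique : ∀ z u c → u < n → z ≡ + u ℤ.+ c ℤ.* + n → z ℤ.%ℕ n ≡ u
  %ℕ-unique z u c u<n z≡ = sym (small-difference-multiple⇒≡ u (z ℤ.%ℕ n) (z ℤ./ℕ n ℤ.- c) u<n (n%ℕd<d z n)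
    (difference-of-multiples (+ u) c (+ (z ℤ.%ℕ n)) (z ℤ./ℕ n) (+ n) (trans (sym z≡) (a≡a%ℕn+[a/ℕn]*n z n))))

  difference-%ℕ≡0⇔ : ∀ k D → (+ k ℤ.- + D) ℤ.%ℕ n ≡ 0 ⇔ k % n ≡ D % n
  difference-%ℕ≡0⇔ k D = mk⇔ same-residue divisible
    where
    c : ℤ
    c = + (k / n) ℤ.- + (D / n)
    expand : + k ℤ.- + D ≡ (+ (k % n) ℤ.- + (D % n)) ℤ.+ c ℤ.* + n
    expand = begin
      + k ℤ.- + D
        ≡⟨ cong₂ (λ a b → + a ℤ.- + b) (m≡m%n+[m/n]*n k n) (m≡m%n+[m/n]*n D n) ⟩
      + (k % n + k / n * n) ℤ.- + (D % n + D / n * n)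
        ≡⟨ cong₂ (λ a b → + (k % n) ℤ.+ a ℤ.- (+ (D % n) ℤ.+ b)) (ℤP.pos-* (k / n) n) (ℤP.pos-* (D / n) n) ⟩
      + (k % n) ℤ.+ + (k / n) ℤ.* + n ℤ.- (+ (D % n) ℤ.+ + (D / n) ℤ.* + n)
        ≡⟨ regroup (+ (k % n)) (+ (k / n)) (+ (D % n)) (+ (D / n)) (+ n) ⟩
      (+ (k % n) ℤ.- + (D % n)) ℤ.+ c ℤ.* + n  ∎
      where
      open ≡-Reasoning
      regroup : ∀ u q v d m → u ℤ.+ q ℤ.* m ℤ.- (v ℤ.+ d ℤ.* m) ≡ (u ℤ.- v) ℤ.+ (q ℤ.- d) ℤ.* m
      regroup = solve-∀
    same-residue : (+ k ℤ.- + D) ℤ.%ℕ n ≡ 0 → k % n ≡ D % n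
    same-residue divisible = small-difference-multiple⇒≡ (k % n) (D % n) (q ℤ.- c) (m%n<n k n) (m%n<n D n)
      (trans (sym (ℤP.+-identityʳ _)) (difference-of-multiples (+ (k % n) ℤ.- + (D % n)) c (+ 0) q (+ n)
        (trans (sym expand) (trans (a≡a%ℕn+[a/ℕn]*n (+ k ℤ.- + D) n) (cong (λ r → + r ℤ.+ q ℤ.* + n) divisible)))))
      where
      q : ℤ
      q = (+ k ℤ.- + D) ℤ./ℕ n
    divisible : k % n ≡ D % n → (+ k ℤ.- + D) ℤ.%ℕ n ≡ 0
    divisible same = %ℕ-unique _ 0 c (ℕ.>-nonZero⁻¹ n) (trans expand
      (cong (ℤ._+ c ℤ.* + n) (trans (cong (λ r → + r ℤ.- + (D % n)) same) (ℤP.+-inverseʳ (+ (D % n))))))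

-- Lists

nth-All : ∀ {A : Set} {P : A → Set} d {xs : List A} → All P xs → ∀ k → k < length xs → P (nth d xs k)
nth-All d (px ∷ _)   zero    _         = px
nth-All d (_  ∷ pxs) (suc k) (s≤s k<n) = nth-All d pxs k k<n

nth-beyond : ∀ {A : Set} (d : A) xs k → length xs ≤ k → nth d xs k ≡ d
nth-beyond d []       k       _         = refl
nth-beyond d (x ∷ xs) (suc k) (s≤s n≤k) = nth-beyond d xs k n≤k

any-≟≡true⇔∈ : ∀ h xs → any (λ l → does (l ℤ.≟ h)) xs ≡ true ⇔ h ∈ xs
any-≟≡true⇔∈ h xs = mk⇔ (found xs) (finds xs)
  where
  found : ∀ xs → any (λ l → does (l ℤ.≟ h)) xs ≡ true → h ∈ xs
  found (l ∷ xs) e with l ℤ.≟ h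
  ... | yes refl = here refl
  ... | no  _    = there (found xs e)
  finds : ∀ xs → h ∈ xs → any (λ l → does (l ℤ.≟ h)) xs ≡ true
  finds (l ∷ xs) h∈ with l ℤ.≟ h | h∈
  ... | yes _   | _          = refl
  ... | no  l≢h | here refl  = ⊥-elim (l≢h refl)
  ... | no  _   | there h∈′ = finds xs h∈′

open InsertionSortP ℤP.≤-decTotalOrder using (sort-↭; sort-↗)

sort-distinct⇒strictly-increasing : ∀ xs → AllPairs _≢_ xs → AllPairs ℤ._<_ (ZSort.sort xs)
sort-distinct⇒strictly-increasing xs distinct = AllPairs.zipWith (λ (x≤y , x≢y) → ℤP.≤∧≢⇒< x≤y x≢y)
  ( Linked⇒AllPairs ℤP.≤-trans (sort-↗ xs)
  , PermutationₛP.Unique-resp-↭ (setoid ℤ) (↭⇒↭ₛ (↭-sym (sort-↭ xs))) distinct)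

module StrictlyIncreasingEnumeration (f : ℕ → ℤ) (hi : ℕ)
    (increasing : ∀ t t′ → t < t′ → t′ < hi → f t ℤ.< f t′) where

  InRange : ℕ → ℤ → Set
  InRange lo s = ∃ λ t → lo ≤ t × t < hi × s ≡ f t

  index-increasing : ∀ {t t′} → t < hi → t′ < hi → f t ℤ.< f t′ → t < t′
  index-increasing {t} {t′} t<hi t′<hi ft<ft′ with ℕP.<-cmp t t′
  ... | tri< t<t′ _ _ = t<t′
  ... | tri≈ _ refl _ = ⊥-elim (ℤP.<-irrefl refl ft<ft′)
  ... | tri> _ _ t′<t = ⊥-elim (ℤP.<-asym ft<ft′ (increasing t′ t t′<t t<hi))

  above-in-range : ∀ {t s} → t < hi → InRange 0 s → f t ℤ.< s → InRange (suc t) s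
  above-in-range t<hi (t′ , _ , t′<hi , refl) ft<s = t′ , index-increasing t<hi t′<hi ft<s , t′<hi , refl

  tail-in-range : ∀ {lo t S} → t < hi → All (f t ℤ.<_) S → All (InRange lo) S → All (InRange (suc t)) S
  tail-in-range t<hi above inRange = All.zipWith (λ (ft<s , (t′ , _ , t′<hi , s≡)) →
    above-in-range t<hi (t′ , z≤n , t′<hi , s≡) ft<s) (above , inRange)

  length-bound : ∀ lo S → AllPairs ℤ._<_ S → All (InRange lo) S → lo ≤ hi → length S + lo ≤ hi
  length-bound lo []      _             _                                  lo≤hi = lo≤hi
  length-bound lo (s ∷ S) (s< ∷ sorted) ((t , lo≤t , t<hi , refl) ∷ inRange) _ = begin
    suc (length S + lo)   ≡⟨ ℕP.+-suc (length S) lo ⟨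
    length S + suc lo     ≤⟨ ℕP.+-monoʳ-≤ (length S) (s≤s lo≤t) ⟩
    length S + suc t      ≤⟨ length-bound (suc t) S sorted (tail-in-range t<hi s< inRange) t<hi ⟩
    hi                    ∎
    where open ℕP.≤-Reasoning

  nth-enumeration : ∀ lo S → AllPairs ℤ._<_ S → All (InRange lo) S → length S + lo ≡ hi →
    ∀ d k → k < length S → nth d S k ≡ f (lo + k)
  nth-enumeration lo (s ∷ S) (s< ∷ sorted) ((t , lo≤t , t<hi , refl) ∷ inRange) full d k k<
    with ℕP.≤-antisym t≤lo lo≤t
    where
    t≤lo : t ≤ lo
    t≤lo = ℕP.≤-pred (ℕP.+-cancelˡ-≤ (length S) _ _ (begin
      length S + suc t     ≤⟨ length-bound (suc t) S sorted (tail-in-range t<hi s< inRange) t<hi ⟩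
      hi                   ≡⟨ full ⟨
      suc (length S + lo)  ≡⟨ ℕP.+-suc (length S) lo ⟨
      length S + suc lo    ∎))
      where open ℕP.≤-Reasoning
  ... | refl with k | k<
  ...   | zero  | _        = cong f (sym (ℕP.+-identityʳ t))
  ...   | suc k | s≤s k<′ = trans
          (nth-enumeration (suc t) S sorted (tail-in-range t<hi s< inRange)
                           (trans (ℕP.+-suc (length S) t) full) d k k<′)
          (cong f (sym (ℕP.+-suc t k)))

-- Counting

boolToℕ : Bool → ℕ
boolToℕ true  = 1
boolToℕ false = 0

countBelow : (ℕ → Bool) → ℕ → ℕ
countBelow P zero    = 0
countBelow P (suc m) = boolToℕ (P 0) + countBelow (λ k → P (suc k)) m

countBelow-suc : ∀ P m → countBelow P (suc m) ≡ countBelow P m + boolToℕ (P m)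
countBelow-suc P zero    = ℕP.+-comm (boolToℕ (P 0)) 0
countBelow-suc P (suc m) = trans (cong (boolToℕ (P 0) ℕ.+_) (countBelow-suc (λ k → P (suc k)) m))
                                 (sym (ℕP.+-assoc (boolToℕ (P 0)) _ _))

countBelow-cong : ∀ P Q m → (∀ k → k < m → P k ≡ Q k) → countBelow P m ≡ countBelow Q m
countBelow-cong P Q zero    _   = refl
countBelow-cong P Q (suc m) P≡Q = cong₂ _+_ (cong boolToℕ (P≡Q 0 (s≤s z≤n)))
  (countBelow-cong (λ k → P (suc k)) (λ k → Q (suc k)) m (λ k k<m → P≡Q (suc k) (s≤s k<m)))

length-filter-applyUpTo : ∀ {A : Set} {P : A → Set} (P? : Decidable P) (g : ℕ → A) m →
  length (filter P? (applyUpTo g m)) ≡ countBelow (λ k → does (P? (g k))) m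
length-filter-applyUpTo P? g zero = refl
length-filter-applyUpTo P? g (suc m) with does (P? (g 0))
... | true  = cong suc (length-filter-applyUpTo P? (λ k → g (suc k)) m)
... | false = length-filter-applyUpTo P? (λ k → g (suc k)) m

countBelow-∧-below : ∀ (P : ℕ → Bool) D m → countBelow (λ k → does (k <? D) ∧ P k) m ≡ countBelow P (m ⊓ D)
countBelow-∧-below P D zero    = refl
countBelow-∧-below P D (suc m) = begin
  countBelow Q (suc m)                         ≡⟨ countBelow-suc Q m ⟩
  countBelow Q m + boolToℕ (Q m)               ≡⟨ cong (_+ boolToℕ (Q m)) (countBelow-∧-below P D m) ⟩
  countBelow P (m ⊓ D) + boolToℕ (Q m)         ≡⟨ last-step (m <? D) ⟩
  countBelow P (suc m ⊓ D)                     ∎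
  where
  open ≡-Reasoning
  Q = λ k → does (k <? D) ∧ P k
  last-step : (m<D? : Dec (m < D)) →
              countBelow P (m ⊓ D) + boolToℕ (does m<D? ∧ P m) ≡ countBelow P (suc m ⊓ D)
  last-step (yes m<D) rewrite ℕP.m≤n⇒m⊓n≡m (ℕP.<⇒≤ m<D) | ℕP.m≤n⇒m⊓n≡m m<D = sym (countBelow-suc P m)
  last-step (no  m≮D) rewrite ℕP.m≥n⇒m⊓n≡n (ℕP.≮⇒≥ m≮D) | ℕP.m≥n⇒m⊓n≡n (ℕP.m≤n⇒m≤1+n (ℕP.≮⇒≥ m≮D)) =
    ℕP.+-identityʳ _

module ResidueCount (n : ℕ) .{{_ : NonZero n}} (ρ : ℕ) (ρ<n : ρ < n) where

  HasResidue : ℕ → Bool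
  HasResidue k = does (k % n ℕ.≟ ρ)

  countBelow-residue : ∀ q s → s ≤ n → countBelow HasResidue (q * n + s) ≡ q + boolToℕ (does (ρ <? s))
  countBelow-residue zero    zero    _   = refl
  countBelow-residue (suc q) zero    _   = begin
    countBelow HasResidue (suc q * n + 0)
      ≡⟨ cong (countBelow HasResidue) (trans (ℕP.+-identityʳ _) (ℕP.+-comm n (q * n))) ⟩
    countBelow HasResidue (q * n + n)       ≡⟨ countBelow-residue q n ℕP.≤-refl ⟩
    q + boolToℕ (does (ρ <? n))             ≡⟨ cong (λ b → q + boolToℕ b) (dec-true (ρ <? n) ρ<n) ⟩
    q + 1                                   ≡⟨ ℕP.+-comm q 1 ⟩
    suc q                                   ≡⟨ ℕP.+-identityʳ (suc q) ⟨
    suc q + 0                               ∎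
    where open ≡-Reasoning
  countBelow-residue q (suc s) s<n = begin
    countBelow HasResidue (q * n + suc s)                         ≡⟨ cong (countBelow HasResidue) (ℕP.+-suc (q * n) s) ⟩
    countBelow HasResidue (suc (q * n + s))                       ≡⟨ countBelow-suc HasResidue (q * n + s) ⟩
    countBelow HasResidue (q * n + s) + boolToℕ (HasResidue (q * n + s))
      ≡⟨ cong₂ _+_ (countBelow-residue q s (ℕP.<⇒≤ s<n)) (cong (λ r → boolToℕ (does (r ℕ.≟ ρ))) residue) ⟩
    q + boolToℕ (does (ρ <? s)) + boolToℕ (does (s ℕ.≟ ρ))      ≡⟨ ℕP.+-assoc q _ _ ⟩
    q + (boolToℕ (does (ρ <? s)) + boolToℕ (does (s ℕ.≟ ρ)))    ≡⟨ cong (q ℕ.+_) (passes-ρ (ℕP.<-cmp ρ s)) ⟩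
    q + boolToℕ (does (ρ <? suc s))                               ∎
    where
    open ≡-Reasoning
    residue : (q * n + s) % n ≡ s
    residue = trans (cong (_% n) (ℕP.+-comm (q * n) s)) (trans ([m+kn]%n≡m%n s q n) (m<n⇒m%n≡m s<n))
    passes-ρ : Tri (ρ < s) (ρ ≡ s) (s < ρ) →
               boolToℕ (does (ρ <? s)) + boolToℕ (does (s ℕ.≟ ρ)) ≡ boolToℕ (does (ρ <? suc s))
    passes-ρ (tri< ρ<s _ _) rewrite dec-true (ρ <? s) ρ<s | dec-false (s ℕ.≟ ρ) (λ e → ℕP.<-irrefl (sym e) ρ<s)
                                  | dec-true (ρ <? suc s) (ℕP.m<n⇒m<1+n ρ<s) = refl
    passes-ρ (tri≈ _ refl _) rewrite dec-false (ρ <? ρ) (ℕP.<-irrefl refl) | dec-true (ρ ℕ.≟ ρ) refl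
                                  | dec-true (ρ <? suc ρ) (ℕP.n<1+n ρ) = refl
    passes-ρ (tri> _ _ s<ρ) rewrite dec-false (ρ <? s) (ℕP.<-asym s<ρ) | dec-false (s ℕ.≟ ρ) (λ e → ℕP.<-irrefl e s<ρ)
                                  | dec-false (ρ <? suc s) (ℕP.<⇒≱ (s≤s s<ρ)) = refl

-- Periodic bijections and the partition κ

module Periodic (n : ℕ) .{{_ : NonZero n}} (ω : ℤ ↔ ℤ)
                (periodic : ∀ z → Inverse.to ω (z ℤ.+ + n) ≡ Inverse.to ω z ℤ.+ + n) where
  open Inverse ω

  to-+-multiple : ∀ z k → to (z ℤ.+ + (k * n)) ≡ to z ℤ.+ + (k * n)
  to-+-multiple z zero    = trans (cong to (ℤP.+-identityʳ z)) (sym (ℤP.+-identityʳ _))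
  to-+-multiple z (suc k) = begin
    to (z ℤ.+ (+ n ℤ.+ + (k * n)))   ≡⟨ cong to (swap z (+ n) _) ⟩
    to ((z ℤ.+ + (k * n)) ℤ.+ + n)   ≡⟨ periodic _ ⟩
    to (z ℤ.+ + (k * n)) ℤ.+ + n     ≡⟨ cong (ℤ._+ + n) (to-+-multiple z k) ⟩
    (to z ℤ.+ + (k * n)) ℤ.+ + n     ≡⟨ swap (to z) (+ n) _ ⟨
    to z ℤ.+ (+ n ℤ.+ + (k * n))     ∎
    where
    open ≡-Reasoning
    swap : ∀ a b c → a ℤ.+ (b ℤ.+ c) ≡ (a ℤ.+ c) ℤ.+ b
    swap = solve-∀

  from-+-multiple : ∀ y k → from (y ℤ.+ + (k * n)) ≡ from y ℤ.+ + (k * n)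
  from-+-multiple y k = begin
    from (y ℤ.+ + (k * n))               ≡⟨ cong (λ w → from (w ℤ.+ + (k * n))) (strictlyInverseˡ y) ⟨
    from (to (from y) ℤ.+ + (k * n))     ≡⟨ cong from (to-+-multiple (from y) k) ⟨
    from (to (from y ℤ.+ + (k * n)))     ≡⟨ strictlyInverseʳ _ ⟩
    from y ℤ.+ + (k * n)                 ∎
    where open ≡-Reasoning

  positive⇒window+multiple : ∀ z → + 1 ℤ.≤ to z →
    ∃ λ t → ∃ λ q → 1 ≤ t × t ≤ n × z ≡ from (+ t) ℤ.+ + (q * n)
  positive⇒window+multiple z 1≤ωz with to z in ωz≡
  positive⇒window+multiple z (ℤ.+≤+ ()) | + zero
  ... | + suc c = suc (c % n) , c / n , s≤s z≤n , m%n<n c n , (begin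
    z                                        ≡⟨ strictlyInverseʳ z ⟨
    from (to z)                              ≡⟨ cong from ωz≡ ⟩
    from (+ suc c)                           ≡⟨ cong (λ w → from (+ suc w)) (m≡m%n+[m/n]*n c n) ⟩
    from (+ suc (c % n) ℤ.+ + (c / n * n))   ≡⟨ from-+-multiple (+ suc (c % n)) (c / n) ⟩
    from (+ suc (c % n)) ℤ.+ + (c / n * n)   ∎)
    where open ≡-Reasoning

  module Dominance (dominant : Dominant n ω) where

    from1≤from : ∀ t → 1 ≤ t → t ≤ n → from (+ 1) ℤ.≤ from (+ t)
    from1≤from 1             _ _   = ℤP.≤-refl
    from1≤from (suc (suc t)) _ t≤n = ℤP.<⇒≤ (dominant 1 (suc (suc t)) (s≤s z≤n) (s≤s (s≤s z≤n)) t≤n)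

    positive⇒from1≤ : ∀ z → + 1 ℤ.≤ to z → from (+ 1) ℤ.≤ z
    positive⇒from1≤ z 1≤ωz with positive⇒window+multiple z 1≤ωz
    ... | t , q , 1≤t , t≤n , refl = ℤP.≤-trans (from1≤from t 1≤t t≤n) (ℤP.i≤i+j (from (+ t)) (+ (q * n)))

module FirstColumn (κ : List ℕ) (positive : All (0 <_) κ) where

  L : ℕ
  L = length κ

  conjPart-1 : conjPart κ 1 ≡ L
  conjPart-1 = cong length (ListP.filter-all (1 ≤?_) positive)

  part-positive : ∀ i → 1 ≤ i → i ≤ L → 1 ≤ part κ i
  part-positive (suc i) _ i<L = nth-All 0 positive i i<L

  part-beyond : ∀ i → L < i → part κ i ≡ 0
  part-beyond (suc i) (s≤s L≤i) = nth-beyond 0 κ i L≤i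

  row≤length : ∀ i → 1 ≤ part κ i → i ≤ L
  row≤length i 1≤κi with i ≤? L
  ... | yes i≤L = i≤L
  ... | no  i≰L = ⊥-elim (ℕP.<-irrefl (sym (part-beyond i (ℕP.≰⇒> i≰L))) 1≤κi)

  hook-first-column : ∀ i → 1 ≤ part κ i → + hook κ i 1 ≡ + part κ i ℤ.+ + L ℤ.- + i
  hook-first-column i 1≤κi = begin
    + (part κ i ∸ 1 + (conjPart κ 1 ∸ i) + 1)      ≡⟨ cong (λ c → + (part κ i ∸ 1 + (c ∸ i) + 1)) conjPart-1 ⟩
    + (part κ i ∸ 1 + (L ∸ i) + 1)                ≡⟨ regroup (+ (part κ i ∸ 1)) (+ (L ∸ i)) (+ i) ⟩
    + (1 + (part κ i ∸ 1)) ℤ.+ + (i + (L ∸ i)) ℤ.- + i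
      ≡⟨ cong₂ (λ a b → + a ℤ.+ + b ℤ.- + i) (ℕP.m+[n∸m]≡n 1≤κi) (ℕP.m+[n∸m]≡n (row≤length i 1≤κi)) ⟩
    + part κ i ℤ.+ + L ℤ.- + i                    ∎
    where
    open ≡-Reasoning
    regroup : ∀ k d i → (k ℤ.+ d) ℤ.+ + 1 ≡ (+ 1 ℤ.+ k) ℤ.+ (i ℤ.+ d) ℤ.- i
    regroup = solve-∀

  shift-α : ∀ h P i → h ℤ.+ (+ 1 ℤ.- + L) ≡ P ℤ.+ + 1 ℤ.- + i ⇔ h ≡ P ℤ.+ + L ℤ.- + i
  shift-α h P i = mk⇔
    (λ e → ℤ-+-cancelʳ-≡ h _ (+ 1 ℤ.- + L) (trans e (sym (identity P (+ L) (+ i)))))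
    (λ e → trans (cong (ℤ._+ (+ 1 ℤ.- + L)) e) (identity P (+ L) (+ i)))
    where
    identity : ∀ P L i → (P ℤ.+ L ℤ.- i) ℤ.+ (+ 1 ℤ.- L) ≡ P ℤ.+ + 1 ℤ.- i
    identity = solve-∀

  firstColHook⇒ : ∀ h → FirstColHook κ h → + 0 ℤ.< h × InAlpha κ (h ℤ.+ (+ 1 ℤ.- + L))
  firstColHook⇒ _ (i , (1≤i , _ , 1≤κi) , refl) =
    ℤ.+<+ (ℕP.m≤n+m 1 _) , i , 1≤i , Equivalence.from (shift-α _ (+ part κ i) i) (hook-first-column i 1≤κi)

  ⇒firstColHook : ∀ h → + 0 ℤ.< h → InAlpha κ (h ℤ.+ (+ 1 ℤ.- + L)) → FirstColHook κ h
  ⇒firstColHook h 0<h (i , 1≤i , e) with i ≤? L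
  ... | yes i≤L = i , (1≤i , ℕP.≤-refl , 1≤κi) ,
                  trans (Equivalence.to (shift-α h (+ part κ i) i) e) (sym (hook-first-column i 1≤κi))
    where 1≤κi = part-positive i 1≤i i≤L
  ... | no  i≰L = ⊥-elim (nonpositive h 0<h h≡L-i)
    where
    h≡L-i : h ≡ + L ℤ.- + i
    h≡L-i = Equivalence.to (shift-α h (+ 0) i)
              (trans e (cong (λ c → + c ℤ.+ + 1 ℤ.- + i) (part-beyond i (ℕP.≰⇒> i≰L))))
    nonpositive : ∀ h → + 0 ℤ.< h → h ≢ + L ℤ.- + i
    nonpositive (+ h) _ e = ℕP.<-irrefl (sym (+-−-cross h 0 L i (trans (ℤP.+-identityʳ (+ h)) e)))
      (subst (_< h + i) (sym (ℕP.+-identityʳ L)) (ℕP.<-≤-trans (ℕP.≰⇒> i≰L) (ℕP.m≤n+m i h)))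

  1-L∉α : ¬ InAlpha κ (+ 1 ℤ.- + L)
  1-L∉α (i , 1≤i , e) with i ≤? L | +-−-cross 1 L (part κ i + 1) i e
  ... | yes i≤L | 1+i≡κi+1+L = ℕP.<-irrefl 1+i≡κi+1+L
        (ℕP.+-mono-<-≤ (ℕP.+-monoˡ-< 1 (part-positive i 1≤i i≤L)) i≤L)
  ... | no  i≰L | 1+i≡κi+1+L = ℕP.<-irrefl (sym i≡L) (ℕP.≰⇒> i≰L)
    where
    i≡L : i ≡ L
    i≡L = ℕP.suc-injective
            (trans 1+i≡κi+1+L (cong (λ c → c + 1 + L) (part-beyond i (ℕP.≰⇒> i≰L))))

  ≤-L⇒α : ∀ z → z ℤ.≤ ℤ.- + L → InAlpha κ z
  ≤-L⇒α z z≤-L with ℤ.- z in -z≡ | ℤP.neg-mono-≤ z≤-L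
  ... | + m | L≤-z = suc m , s≤s z≤n , (begin
    z                                     ≡⟨ ℤP.neg-involutive z ⟨
    ℤ.- (ℤ.- z)                           ≡⟨ cong ℤ.-_ -z≡ ⟩
    ℤ.- + m                               ≡⟨ negate (+ m) ⟩
    + 0 ℤ.+ + 1 ℤ.- + suc m               ≡⟨ cong (λ c → + c ℤ.+ + 1 ℤ.- + suc m) (part-beyond (suc m) (s≤s L≤m)) ⟨
    + part κ (suc m) ℤ.+ + 1 ℤ.- + suc m  ∎)
    where
    open ≡-Reasoning
    negate : ∀ m → ℤ.- m ≡ + 0 ℤ.+ + 1 ℤ.- (+ 1 ℤ.+ m)
    negate = solve-∀
    L≤m : L ≤ m
    L≤m = ℤP.drop‿+≤+ (subst (ℤ._≤ + m) (ℤP.neg-involutive (+ L)) L≤-z)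
  ... | ℤ.-[1+ m ] | L≤-z with () ← subst (ℤ._≤ ℤ.-[1+ m ]) (ℤP.neg-involutive (+ L)) L≤-z

module WindowOfCore (n : ℕ) .{{_ : NonZero n}} (ω : ℤ ↔ ℤ)
    (periodic : ∀ z → Inverse.to ω (z ℤ.+ + n) ≡ Inverse.to ω z ℤ.+ + n)
    (dominant : Dominant n ω) (κ : List ℕ) (positive : All (0 <_) κ)
    (α≡ : ∀ z → InAlpha κ z ⇔ (Inverse.to ω z ℤ.≤ + 0)) where
  open Inverse ω
  open Periodic n ω periodic
  open Dominance dominant
  open FirstColumn κ positive

  ∉α⇒positive : ∀ z → ¬ InAlpha κ z → + 1 ℤ.≤ to z
  ∉α⇒positive z z∉α with to z ℤ.≤? + 0
  ... | yes ωz≤0 = ⊥-elim (z∉α (Equivalence.from (α≡ z) ωz≤0))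
  ... | no  ωz≰0 = ℤP.i<j⇒suc[i]≤j (ℤP.≰⇒> ωz≰0)

  from1≡1-L : from (+ 1) ≡ + 1 ℤ.- + L
  from1≡1-L = ℤP.≤-antisym (positive⇒from1≤ _ (∉α⇒positive _ 1-L∉α))
                           (ℤP.i<j⇒suc[i]≤j (ℤP.≰⇒> from1≰-L))
    where
    from1≰-L : ¬ (from (+ 1) ℤ.≤ ℤ.- + L)
    from1≰-L from1≤-L = ℤP.<⇒≱ (subst (+ 0 ℤ.<_) (sym (strictlyInverseˡ (+ 1))) (ℤ.+<+ (s≤s z≤n)))
                               (Equivalence.to (α≡ _) (≤-L⇒α _ from1≤-L))

  firstColHook⇔ : ∀ h → FirstColHook κ h ⇔ (+ 0 ℤ.< h × to (h ℤ.+ from (+ 1)) ℤ.≤ + 0)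
  firstColHook⇔ h = mk⇔
    (λ hook → let 0<h , h+a₁∈α = firstColHook⇒ h hook in
              0<h , Equivalence.to (α≡ _) (subst (λ a₁ → InAlpha κ (h ℤ.+ a₁)) (sym from1≡1-L) h+a₁∈α))
    (λ (0<h , ωh+a₁≤0) → ⇒firstColHook h 0<h
              (subst (λ a₁ → InAlpha κ (h ℤ.+ a₁)) from1≡1-L (Equivalence.from (α≡ _) ωh+a₁≤0)))

-- Lattice paths

-- The lattice points behind northLabelsFrom and squaresBelowFrom: the starting points of the
-- North steps, and the bottom-right corners of the unit squares below the path.
column : ℕ → ℕ → List (ℕ × ℕ)
column i j = applyUpTo (i ,_) j

northPoints : ℕ → ℕ → List Step → List (ℕ × ℕ)
northPoints i j []       = []
northPoints i j (N ∷ xs) = (i , j) ∷ northPoints i (suc j) xs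
northPoints i j (E ∷ xs) = northPoints (suc i) j xs

squarePoints : ℕ → ℕ → List Step → List (ℕ × ℕ)
squarePoints i j []       = []
squarePoints i j (N ∷ xs) = squarePoints i (suc j) xs
squarePoints i j (E ∷ xs) = column (suc i) j ++ squarePoints (suc i) j xs

∈-column⁻ : ∀ {i j a b} → (a , b) ∈ column i j → a ≡ i × b < j
∈-column⁻ {i} m with ∈-applyUpTo⁻ (i ,_) m
... | _ , b<j , refl = refl , b<j

length-northPoints : ∀ i j xs → length (northPoints i j xs) ≡ count N xs
length-northPoints i j []       = refl
length-northPoints i j (N ∷ xs) = cong suc (length-northPoints i (suc j) xs)
length-northPoints i j (E ∷ xs) = length-northPoints (suc i) j xs

northPoint-row≥ : ∀ i j xs {a b} → (a , b) ∈ northPoints i j xs → j ≤ b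
northPoint-row≥ i j (N ∷ xs) (here refl) = ℕP.≤-refl
northPoint-row≥ i j (N ∷ xs) (there m)   = ℕP.<⇒≤ (northPoint-row≥ i (suc j) xs m)
northPoint-row≥ i j (E ∷ xs) m           = northPoint-row≥ (suc i) j xs m

northPoint-row< : ∀ i j xs {a b} → (a , b) ∈ northPoints i j xs → b < j + count N xs
northPoint-row< i j (N ∷ xs) (here refl) =
  subst (j <_) (sym (ℕP.+-suc j (count N xs))) (ℕP.m≤m+n (suc j) (count N xs))
northPoint-row< i j (N ∷ xs) {b = b} (there m) =
  subst (b <_) (sym (ℕP.+-suc j (count N xs))) (northPoint-row< i (suc j) xs m)
northPoint-row< i j (E ∷ xs) m = northPoint-row< (suc i) j xs m

squarePoint-row< : ∀ i j xs {a b} → (a , b) ∈ squarePoints i j xs → b < j + count N xs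
squarePoint-row< i j (N ∷ xs) {b = b} m =
  subst (b <_) (sym (ℕP.+-suc j (count N xs))) (squarePoint-row< i (suc j) xs m)
squarePoint-row< i j (E ∷ xs) m with ∈-++⁻ (column (suc i) j) m
... | inj₁ m′ = ℕP.<-≤-trans (proj₂ (∈-column⁻ m′)) (ℕP.m≤m+n j (count N xs))
... | inj₂ m′ = squarePoint-row< (suc i) j xs m′

squarePoint-column> : ∀ i j xs {a b} → (a , b) ∈ squarePoints i j xs → i < a
squarePoint-column> i j (N ∷ xs) m = squarePoint-column> i (suc j) xs m
squarePoint-column> i j (E ∷ xs) m with ∈-++⁻ (column (suc i) j) m
... | inj₁ m′ = ℕP.≤-reflexive (sym (proj₁ (∈-column⁻ m′)))
... | inj₂ m′ = ℕP.<⇒≤ (squarePoint-column> (suc i) j xs m′)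

northPoint∉squarePoints : ∀ i j xs {u} → u ∈ northPoints i j xs → ¬ (u ∈ squarePoints i j xs)
northPoint∉squarePoints i j (N ∷ xs) (here refl) m =
  ℕP.<-irrefl refl (squarePoint-column> i (suc j) xs m)
northPoint∉squarePoints i j (N ∷ xs) (there mn) m = northPoint∉squarePoints i (suc j) xs mn m
northPoint∉squarePoints i j (E ∷ xs) {a , b} mn m with ∈-++⁻ (column (suc i) j) m
... | inj₁ m′ = ℕP.<⇒≱ (proj₂ (∈-column⁻ m′)) (northPoint-row≥ (suc i) j xs mn)
... | inj₂ m′ = northPoint∉squarePoints (suc i) j xs mn m′

squarePoints-right-of : ∀ i j xs c b → i < c → c ≤ i + count E xs → b < j → (c , b) ∈ squarePoints i j xs
squarePoints-right-of i j [] c b i<c c≤i _ =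
  ⊥-elim (ℕP.<⇒≱ i<c (subst (c ≤_) (ℕP.+-identityʳ i) c≤i))
squarePoints-right-of i j (N ∷ xs) c b i<c c≤ b<j =
  squarePoints-right-of i (suc j) xs c b i<c c≤ (ℕP.m<n⇒m<1+n b<j)
squarePoints-right-of i j (E ∷ xs) c b i<c c≤ b<j with ℕP.m≤n⇒m<n∨m≡n i<c
... | inj₂ refl = ∈-++⁺ˡ (∈-applyUpTo⁺ (suc i ,_) b<j)
... | inj₁ i+1<c = ∈-++⁺ʳ (column (suc i) j)
      (squarePoints-right-of (suc i) j xs c b i+1<c (subst (c ≤_) (ℕP.+-suc i (count E xs)) c≤) b<j)

squarePoints-right-of-north : ∀ i j xs {a b} → (a , b) ∈ northPoints i j xs →
  ∀ c → a < c → c ≤ i + count E xs → (c , b) ∈ squarePoints i j xs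
squarePoints-right-of-north i j (N ∷ xs) (here refl) c a<c c≤ =
  squarePoints-right-of i (suc j) xs c j a<c c≤ (ℕP.n<1+n j)
squarePoints-right-of-north i j (N ∷ xs) (there m) c a<c c≤ =
  squarePoints-right-of-north i (suc j) xs m c a<c c≤
squarePoints-right-of-north i j (E ∷ xs) m c a<c c≤ = ∈-++⁺ʳ (column (suc i) j)
  (squarePoints-right-of-north (suc i) j xs m c a<c (subst (c ≤_) (ℕP.+-suc i (count E xs)) c≤))

module Labels (n p : ℕ) where

  labelOf : ℕ × ℕ → ℤ
  labelOf (a , b) = label n p a b

  northLabels≡ : ∀ i j xs → northLabelsFrom n p i j xs ≡ map labelOf (northPoints i j xs)
  northLabels≡ i j []       = refl
  northLabels≡ i j (N ∷ xs) = cong (label n p i j ∷_) (northLabels≡ i (suc j) xs)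
  northLabels≡ i j (E ∷ xs) = northLabels≡ (suc i) j xs

  squareLabels≡ : ∀ i j xs → squaresBelowFrom n p i j xs ≡ map labelOf (squarePoints i j xs)
  squareLabels≡ i j []       = refl
  squareLabels≡ i j (N ∷ xs) = squareLabels≡ i (suc j) xs
  squareLabels≡ i j (E ∷ xs) = begin
    applyUpTo (label n p (suc i)) j ++ squaresBelowFrom n p (suc i) j xs
      ≡⟨ cong₂ _++_ (ListP.map-applyUpTo (suc i ,_) labelOf j) (sym (squareLabels≡ (suc i) j xs)) ⟨
    map labelOf (column (suc i) j) ++ map labelOf (squarePoints (suc i) j xs)
      ≡⟨ ListP.map-++ labelOf (column (suc i) j) (squarePoints (suc i) j xs) ⟨
    map labelOf (column (suc i) j ++ squarePoints (suc i) j xs)  ∎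
    where open ≡-Reasoning

  label-−-multiple : ∀ a b q → label n p a b ℤ.- + (q * n) ≡ label n p (a + q) b
  label-−-multiple a b q = trans (assoc (+ (b * p)) (+ (a * n)) (+ (q * n)))
                                 (cong (λ c → + (b * p) ℤ.- + c) (sym (ℕP.*-distribʳ-+ n a q)))
    where
    assoc : ∀ x y z → x ℤ.- y ℤ.- z ≡ x ℤ.- (y ℤ.+ z)
    assoc = solve-∀

  AboveDiagonalFrom : ℕ → ℕ → List Step → Set
  AboveDiagonalFrom i j xs =
    ∀ k → (i + count E (take k xs)) * n ≤ (j + count N (take k xs)) * p

  northPoint-above-diagonal : ∀ i j xs → AboveDiagonalFrom i j xs →
    ∀ {a b} → (a , b) ∈ northPoints i j xs → a * n ≤ b * p
  northPoint-above-diagonal i j (N ∷ xs) above (here refl) =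
    subst₂ (λ u v → u * n ≤ v * p) (ℕP.+-identityʳ i) (ℕP.+-identityʳ j) (above 0)
  northPoint-above-diagonal i j (N ∷ xs) above (there m) = northPoint-above-diagonal i (suc j) xs
    (λ k → subst (λ v → (i + count E (take k xs)) * n ≤ v * p) (ℕP.+-suc j _) (above (suc k))) m
  northPoint-above-diagonal i j (E ∷ xs) above m = northPoint-above-diagonal (suc i) j xs
    (λ k → subst (λ u → u * n ≤ (j + count N (take k xs)) * p) (ℕP.+-suc i _) (above (suc k))) m

module CoprimeLabels (n p : ℕ) .{{_ : NonZero n}} (coprime : Coprime n p) where

  small-multiple≡0 : ∀ b → b < n → n ∣ p * b → b ≡ 0
  small-multiple≡0 zero    _   _   = refl
  small-multiple≡0 (suc b) b<n n∣ = ⊥-elim (ℕP.<⇒≱ b<n (∣⇒≤ (coprime-divisor coprime n∣)))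

  distinct-rows⇒label≢ : ∀ a b c d → b < d → d < n → label n p a b ≢ label n p c d
  distinct-rows⇒label≢ a b c d b<d d<n label≡ = ℕP.<-irrefl (sym δ≡0) (ℕP.m<n⇒0<n∸m b<d)
    where
    δ = d ∸ b
    e : b * p + c * n ≡ d * p + a * n
    e = +-−-cross (b * p) (a * n) (d * p) (c * n) label≡
    cn≡δp+an : c * n ≡ δ * p + a * n
    cn≡δp+an = ℕP.+-cancelˡ-≡ (b * p) _ _ (begin
      b * p + c * n              ≡⟨ e ⟩
      d * p + a * n              ≡⟨ cong (λ x → x * p + a * n) (ℕP.m+[n∸m]≡n (ℕP.<⇒≤ b<d)) ⟨
      (b + δ) * p + a * n        ≡⟨ cong (_+ a * n) (ℕP.*-distribʳ-+ p b δ) ⟩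
      b * p + δ * p + a * n      ≡⟨ ℕP.+-assoc (b * p) _ _ ⟩
      b * p + (δ * p + a * n)    ∎)
      where open ≡-Reasoning
    pδ≡[c∸a]n : p * δ ≡ (c ∸ a) * n
    pδ≡[c∸a]n = begin
      p * δ                      ≡⟨ ℕP.*-comm p δ ⟩
      δ * p                      ≡⟨ ℕP.m+n∸n≡m (δ * p) (a * n) ⟨
      δ * p + a * n ∸ a * n      ≡⟨ cong (_∸ a * n) cn≡δp+an ⟨
      c * n ∸ a * n              ≡⟨ ℕP.*-distribʳ-∸ n c a ⟨
      (c ∸ a) * n                ∎
      where open ≡-Reasoning
    δ≡0 : δ ≡ 0
    δ≡0 = small-multiple≡0 δ (ℕP.≤-<-trans (ℕP.m∸n≤m d b) d<n) (divides (c ∸ a) pδ≡[c∸a]n)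

  label-row-injective : ∀ a b c d → b < n → d < n → label n p a b ≡ label n p c d → b ≡ d
  label-row-injective a b c d b<n d<n e with ℕP.<-cmp b d
  ... | tri≈ _ b≡d _ = b≡d
  ... | tri< b<d _ _ = ⊥-elim (distinct-rows⇒label≢ a b c d b<d d<n e)
  ... | tri> _ _ d<b = ⊥-elim (distinct-rows⇒label≢ c d a b d<b b<n (sym e))

  label-column-injective : ∀ a b c → label n p a b ≡ label n p c b → a ≡ c
  label-column-injective a b c e = sym (ℕP.*-cancelʳ-≡ c a n
    (ℕP.+-cancelˡ-≡ (b * p) _ _ (+-−-cross (b * p) (a * n) (b * p) (c * n) e)))

  label≢positive-multiple : ∀ a b q → b < n → 1 ≤ q → label n p a b ≢ + (q * n)
  label≢positive-multiple a b q b<n 1≤q e = ℕP.<-irrefl (sym [q+a]n≡0) (ℕP.<-≤-trans 0<n n≤[q+a]n)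
    where
    0<n : 0 < n
    0<n = ℕ.>-nonZero⁻¹ n
    pb≡[q+a]n : p * b ≡ (q + a) * n
    pb≡[q+a]n = begin
      p * b                 ≡⟨ ℕP.*-comm p b ⟩
      b * p                 ≡⟨ ℕP.+-identityʳ (b * p) ⟨
      b * p + 0             ≡⟨ +-−-cross (b * p) (a * n) (q * n) 0 (trans e (sym (ℤP.+-identityʳ _))) ⟩
      q * n + a * n         ≡⟨ ℕP.*-distribʳ-+ n q a ⟨
      (q + a) * n           ∎
      where open ≡-Reasoning
    [q+a]n≡0 : (q + a) * n ≡ 0
    [q+a]n≡0 = trans (sym pb≡[q+a]n)
      (trans (cong (p *_) (small-multiple≡0 b b<n (divides (q + a) pb≡[q+a]n))) (ℕP.*-zeroʳ p))
    n≤[q+a]n : n ≤ (q + a) * n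
    n≤[q+a]n = ℕP.≤-trans (ℕP.m≤m+n n 0) (ℕP.*-monoˡ-≤ n (ℕP.≤-trans 1≤q (ℕP.m≤m+n q a)))

  open Labels n p

  northPoints-labels-distinct : ∀ i j xs → j + count N xs ≤ n →
    AllPairs (λ u v → labelOf u ≢ labelOf v) (northPoints i j xs)
  northPoints-labels-distinct i j []       _ = []
  northPoints-labels-distinct i j (E ∷ xs) ≤n = northPoints-labels-distinct (suc i) j xs ≤n
  northPoints-labels-distinct i j (N ∷ xs) ≤n =
    All.tabulate differs ∷ northPoints-labels-distinct i (suc j) xs ≤n′
    where
    ≤n′ : suc j + count N xs ≤ n
    ≤n′ = subst (_≤ n) (ℕP.+-suc j (count N xs)) ≤n
    differs : ∀ {v} → v ∈ northPoints i (suc j) xs → labelOf (i , j) ≢ labelOf v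
    differs {a , b} m = distinct-rows⇒label≢ i j a b (northPoint-row≥ i (suc j) xs m)
                          (ℕP.<-≤-trans (northPoint-row< i (suc j) xs m) ≤n′)

module DyckPath (n p : ℕ) .{{_ : NonZero n}} (coprime : Coprime n p)
                (x : List Step) (dyck : IsDyck n p x) where
  open Labels n p
  open CoprimeLabels n p coprime

  northLabels squareLabels : List ℤ
  northLabels  = northLabelsFrom n p 0 0 x
  squareLabels = squaresBelowFrom n p 0 0 x

  private
    count-N : count N x ≡ n
    count-N = proj₁ dyck
    count-E : count E x ≡ p
    count-E = proj₁ (proj₂ dyck)
    above-diagonal : AboveDiagonalFrom 0 0 x
    above-diagonal = proj₂ (proj₂ dyck)

  length-northLabels : length northLabels ≡ n
  length-northLabels = begin
    length northLabels                           ≡⟨ cong length (northLabels≡ 0 0 x) ⟩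
    length (map labelOf (northPoints 0 0 x))     ≡⟨ ListP.length-map labelOf (northPoints 0 0 x) ⟩
    length (northPoints 0 0 x)                   ≡⟨ length-northPoints 0 0 x ⟩
    count N x                                    ≡⟨ count-N ⟩
    n                                            ∎
    where open ≡-Reasoning

  northLabels-distinct : AllPairs _≢_ northLabels
  northLabels-distinct = subst (AllPairs _≢_) (sym (northLabels≡ 0 0 x))
    (AllPairsP.map⁺ (northPoints-labels-distinct 0 0 x (ℕP.≤-reflexive count-N)))

  northLabel-point : ∀ {ℓ} → ℓ ∈ northLabels → ∃ λ u → u ∈ northPoints 0 0 x × ℓ ≡ labelOf u
  northLabel-point m = ∈-map⁻ labelOf (subst (_ ∈_) (northLabels≡ 0 0 x) m)

  northPoint-row<n : ∀ {a b} → (a , b) ∈ northPoints 0 0 x → b < n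
  northPoint-row<n m = subst (_ <_) count-N (northPoint-row< 0 0 x m)

  northLabel-nonnegative : ∀ {ℓ} → ℓ ∈ northLabels → + 0 ℤ.≤ ℓ
  northLabel-nonnegative m with northLabel-point m
  ... | (a , b) , mp , refl =
    ℤP.i≤j⇒0≤j-i (ℤ.+≤+ (northPoint-above-diagonal 0 0 x above-diagonal mp))

  northLabel∉squareLabels : ∀ {ℓ} → ℓ ∈ northLabels → ¬ (ℓ ∈ squareLabels)
  northLabel∉squareLabels m ms with northLabel-point m
  ... | (a , b) , mp , refl with ∈-map⁻ labelOf (subst (_ ∈_) (squareLabels≡ 0 0 x) ms)
  ...   | (c , d) , msq , e = northPoint∉squarePoints 0 0 x mp
          (subst₂ (λ u v → (u , v) ∈ squarePoints 0 0 x) c≡a d≡b msq)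
    where
    d≡b : d ≡ b
    d≡b = label-row-injective c d a b (subst (_ <_) count-N (squarePoint-row< 0 0 x msq))
                              (northPoint-row<n mp) (sym e)
    c≡a : c ≡ a
    c≡a = label-column-injective c b a (subst (λ w → label n p c w ≡ label n p a b) d≡b (sym e))

  northLabel≢positive-multiple : ∀ {ℓ} → ℓ ∈ northLabels → ∀ q → 1 ≤ q → ℓ ≢ + (q * n)
  northLabel≢positive-multiple m q 1≤q with northLabel-point m
  ... | (a , b) , mp , refl = label≢positive-multiple a b q (northPoint-row<n mp) 1≤q

  northLabel-−-multiple∈squareLabels : ∀ {ℓ} → ℓ ∈ northLabels → ∀ q → 1 ≤ q →
    + 0 ℤ.< ℓ ℤ.- + (q * n) → ℓ ℤ.- + (q * n) ∈ squareLabels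
  northLabel-−-multiple∈squareLabels m q 1≤q 0<ℓ-qn with northLabel-point m
  ... | (a , b) , mp , refl = subst₂ _∈_ (sym (label-−-multiple a b q)) (sym (squareLabels≡ 0 0 x))
          (∈-map⁺ labelOf (squarePoints-right-of-north 0 0 x mp (a + q) (ℕP.m<m+n a 1≤q) a+q≤p))
    where
    [a+q]n<bp : (a + q) * n < b * p
    [a+q]n<bp = 0<x-y⇒y<x (b * p) ((a + q) * n) (subst (+ 0 ℤ.<_) (label-−-multiple a b q) 0<ℓ-qn)
    a+q≤p : a + q ≤ 0 + count E x
    a+q≤p = subst (a + q ≤_) (sym count-E) (ℕP.<⇒≤ (ℕP.*-cancelʳ-< n (a + q) p
              (ℕP.<-≤-trans [a+q]n<bp (ℕP.≤-trans (ℕP.*-monoˡ-≤ p (ℕP.<⇒≤ (northPoint-row<n mp)))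
                                                   (ℕP.≤-reflexive (ℕP.*-comm n p))))))

-- The Shi tableau

-- shiTableau n p ω i j unfolds to a test of shiCondition n (p % n) (sPerm i) (sPerm j).
shiCondition : ℕ → ℕ → ℕ → ℕ → Bool
shiCondition n r sᵢ sⱼ = does (+ r ℤ.+ + sᵢ ℤ.<? + sⱼ)
                       ∨ (does (+ sᵢ ℤ.+ + r ℤ.- + n ℤ.<? + sⱼ) ∧ does (+ sⱼ ℤ.<? + sᵢ))

shiCondition-unwrapped : ∀ n r u ρ → shiCondition n r (suc u) (suc (u + ρ)) ≡ does (r <? ρ)
shiCondition-unwrapped n r u ρ
  rewrite dec-false (+ suc (u + ρ) ℤ.<? + suc u) (λ lt → ℕP.<⇒≱ (ℤP.drop‿+<+ lt) (s≤s (ℕP.m≤m+n u ρ)))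
        | BoolP.∧-zeroʳ (does (+ suc u ℤ.+ + r ℤ.- + n ℤ.<? + suc (u + ρ)))
        | BoolP.∨-identityʳ (does (+ r ℤ.+ + suc u ℤ.<? + suc (u + ρ)))
  = does-⇔ (mk⇔ (λ lt → ℕP.+-cancelˡ-< (suc u) r ρ (subst (_< suc u + ρ) (ℕP.+-comm r (suc u)) (ℤP.drop‿+<+ lt)))
                (λ lt → ℤ.+<+ (subst (_< suc u + ρ) (ℕP.+-comm (suc u) r) (ℕP.+-monoʳ-< (suc u) lt))))
           (+ r ℤ.+ + suc u ℤ.<? + suc (u + ρ)) (r <? ρ)

shiCondition-wrapped : ∀ n r u ρ w → u + ρ ≡ n + w → ρ < n → shiCondition n r (suc u) (suc w) ≡ does (r <? ρ)
shiCondition-wrapped n r u ρ w u+ρ≡n+w ρ<n = evaluate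
  where
  w+n≡u+ρ : w + n ≡ u + ρ
  w+n≡u+ρ = trans (ℕP.+-comm w n) (sym u+ρ≡n+w)
  w<u : w < u
  w<u = ℕP.+-cancelʳ-< n w u (subst (_< u + n) (sym w+n≡u+ρ) (ℕP.+-monoʳ-< u ρ<n))
  middle⇔ : + suc u ℤ.+ + r ℤ.- + n ℤ.< + suc w ⇔ r < ρ
  middle⇔ = mk⇔
    (λ lt → ℕP.+-cancelˡ-< u r ρ (subst (u + r <_) w+n≡u+ρ (ℕ.s<s⁻¹ (Equivalence.to (x-y<z⇔x<z+y _ n _) lt))))
    (λ lt → Equivalence.from (x-y<z⇔x<z+y _ n _) (ℕ.s<s (subst (u + r <_) (sym w+n≡u+ρ) (ℕP.+-monoʳ-< u lt))))
  evaluate : shiCondition n r (suc u) (suc w) ≡ does (r <? ρ)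
  evaluate
    rewrite dec-false (+ r ℤ.+ + suc u ℤ.<? + suc w)
                      (λ lt → ℕP.<-asym (ℤP.drop‿+<+ lt) (ℕP.<-≤-trans (s≤s w<u) (ℕP.m≤n+m (suc u) r)))
          | dec-true (+ suc w ℤ.<? + suc u) (ℤ.+<+ (s≤s w<u))
          | BoolP.∧-identityʳ (does (+ suc u ℤ.+ + r ℤ.- + n ℤ.<? + suc w))
    = does-⇔ middle⇔ (+ suc u ℤ.+ + r ℤ.- + n ℤ.<? + suc w) (r <? ρ)

module ShiTableauEqualsCodinv
    (n p : ℕ) .{{_ : NonZero n}} .{{_ : NonZero p}} (coprime : Coprime n p)
    (ω : ℤ ↔ ℤ) (affine : IsAffinePerm n ω) (dominant : Dominant n ω) (stable : PStable p ω)
    (x : List Step) (dyck : IsDyck n p x) (κ : List ℕ) (partition : IsPartition κ)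
    (α≡ : ∀ z → InAlpha κ z ⇔ (Inverse.to ω z ℤ.≤ + 0))
    (H≡ : ∀ h → FirstColHook κ h ⇔ (inH n p x h ≡ true)) where
  open Inverse ω
  open Periodic n ω (proj₁ affine)
  open Dominance dominant
  open WindowOfCore n ω (proj₁ affine) dominant κ (proj₁ partition) α≡
  open DyckPath n p coprime x dyck

  a : ℕ → ℤ
  a t = from (+ t)

  ω-a : ∀ t → to (a t) ≡ + t
  ω-a t = strictlyInverseˡ (+ t)

  inH⇔ : ∀ h → inH n p x h ≡ true ⇔ (+ 0 ℤ.< h × to (h ℤ.+ a 1) ℤ.≤ + 0)
  inH⇔ h = ⇔.trans (⇔.sym (H≡ h)) (firstColHook⇔ h)

  inH⇔squareLabel : ∀ h → + 0 ℤ.< h → inH n p x h ≡ true ⇔ h ∈ squareLabels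
  inH⇔squareLabel h 0<h rewrite dec-true (+ 0 ℤ.<? h) 0<h = any-≟≡true⇔∈ h squareLabels

  northLabel+a₁-positive : ∀ {ℓ} → ℓ ∈ northLabels → + 1 ℤ.≤ to (ℓ ℤ.+ a 1)
  northLabel+a₁-positive {ℓ} m with ℓ | northLabel-nonnegative m | m
  ... | + zero  | _ | _  = ℤP.≤-reflexive (sym (trans (cong to (ℤP.+-identityˡ (a 1))) (ω-a 1)))
  ... | + suc k | _ | m′ with to (+ suc k ℤ.+ a 1) ℤ.≤? + 0
  ...   | no  ω≰0 = ℤP.i<j⇒suc[i]≤j (ℤP.≰⇒> ω≰0)
  ...   | yes ω≤0 = ⊥-elim (northLabel∉squareLabels m′
            (Equivalence.to (inH⇔squareLabel _ 0<ℓ) (Equivalence.from (inH⇔ _) (0<ℓ , ω≤0))))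
    where 0<ℓ = ℤ.+<+ (s≤s z≤n)

  northLabel-−-multiple≢windowLabel : ∀ {ℓ} → ℓ ∈ northLabels → ∀ t q → 1 ≤ t → t ≤ n →
    ℓ ℤ.- + (suc q * n) ≢ a t ℤ.- a 1
  northLabel-−-multiple≢windowLabel {ℓ} m t q 1≤t t≤n shifted with + 0 ℤ.<? a t ℤ.- a 1
  ... | yes 0< = ℤP.<⇒≱ (subst (+ 0 ℤ.<_) (sym (ω-a t)) (ℤ.+<+ 1≤t))
                        (subst (λ z → to z ℤ.≤ + 0) (trans (cong (ℤ._+ a 1) shifted) (ℤ-−+-cancel (a t) (a 1)))
                               (proj₂ (Equivalence.to (inH⇔ _) (Equivalence.from (inH⇔squareLabel _ 0<ℓ-Q) ℓ-Q∈))))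
    where
    0<ℓ-Q = subst (+ 0 ℤ.<_) (sym shifted) 0<
    ℓ-Q∈ = northLabel-−-multiple∈squareLabels m (suc q) (s≤s z≤n) 0<ℓ-Q
  ... | no  0≮ = northLabel≢positive-multiple m (suc q) (s≤s z≤n) (begin
    ℓ                                ≡⟨ ℤ-−+-cancel ℓ (+ (suc q * n)) ⟨
    ℓ ℤ.- + (suc q * n) ℤ.+ + (suc q * n) ≡⟨ cong (ℤ._+ + (suc q * n)) (trans shifted aₜ-a₁≡0) ⟩
    + 0 ℤ.+ + (suc q * n)            ≡⟨ ℤP.+-identityˡ _ ⟩
    + (suc q * n)                    ∎)
    where
    open ≡-Reasoning
    aₜ-a₁≡0 : a t ℤ.- a 1 ≡ + 0
    aₜ-a₁≡0 = ℤP.≤-antisym (ℤP.≮⇒≥ 0≮) (ℤP.i≤j⇒0≤j-i (from1≤from t 1≤t t≤n))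

  northLabel≡windowLabel : ∀ {ℓ} → ℓ ∈ northLabels → ∃ λ t → 1 ≤ t × t ≤ n × ℓ ≡ a t ℤ.- a 1
  northLabel≡windowLabel {ℓ} m with positive⇒window+multiple (ℓ ℤ.+ a 1) (northLabel+a₁-positive m)
  ... | t , zero  , 1≤t , t≤n , e = t , 1≤t , t≤n , trans (sym (ℤP.+-identityʳ ℓ)) (+≡+⇒−≡− ℓ (a 1) (a t) (+ 0) e)
  ... | t , suc q , 1≤t , t≤n , e =
    ⊥-elim (northLabel-−-multiple≢windowLabel m t q 1≤t t≤n (+≡+⇒−≡− ℓ (a 1) (a t) (+ (suc q * n)) e))

  windowLabel : ℕ → ℤ
  windowLabel t = a (suc t) ℤ.- a 1

  windowLabel-increasing : ∀ t t′ → t < t′ → t′ < n → windowLabel t ℤ.< windowLabel t′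
  windowLabel-increasing t t′ t<t′ t′<n =
    ℤP.+-monoˡ-< (ℤ.- a 1) (dominant (suc t) (suc t′) (s≤s z≤n) (s≤s t<t′) t′<n)

  open StrictlyIncreasingEnumeration windowLabel n windowLabel-increasing

  ellN≡ : ∀ i → 1 ≤ i → i ≤ n → ellN n p x i ≡ a i ℤ.- a 1
  ellN≡ (suc i) _ i<n = nth-enumeration 0 sorted
    (sort-distinct⇒strictly-increasing northLabels northLabels-distinct)
    (All.tabulate (λ ℓ∈ → inRange (northLabel≡windowLabel (PermutationP.∈-resp-↭ (sort-↭ northLabels) ℓ∈))))
    (trans (ℕP.+-identityʳ _) length-sorted) (+ 0) i (subst (i <_) (sym length-sorted) i<n)
    where
    sorted = ZSort.sort northLabels
    length-sorted : length sorted ≡ n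
    length-sorted = trans (PermutationP.↭-length (sort-↭ northLabels)) length-northLabels
    inRange : ∀ {ℓ} → (∃ λ t → 1 ≤ t × t ≤ n × ℓ ≡ a t ℤ.- a 1) → InRange 0 ℓ
    inRange (suc t , _ , t<n , e) = t , z≤n , t<n , e

  module Entry (i j : ℕ) (1≤i : 1 ≤ i) (i<j : i < j) (j≤n : j ≤ n) where

    D K ρ m r : ℕ
    D = ℤ.∣ a j ℤ.- a i ∣
    K = D / n
    ρ = D % n
    m = p / n
    r = p % n

    open Residues n

    i≤n : i ≤ n
    i≤n = ℕP.<⇒≤ (ℕP.<-≤-trans i<j j≤n)

    1≤j : 1 ≤ j
    1≤j = ℕP.<⇒≤ (ℕP.≤-<-trans 1≤i i<j)

    ρ<n : ρ < n
    ρ<n = m%n<n D n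

    D≡ρ+Kn : D ≡ ρ + K * n
    D≡ρ+Kn = m≡m%n+[m/n]*n D n

    aⱼ-aᵢ≡D : a j ℤ.- a i ≡ + D
    aⱼ-aᵢ≡D = sym (ℤP.0≤i⇒+∣i∣≡i (ℤP.i≤j⇒0≤j-i (ℤP.<⇒≤ (dominant i j 1≤i i<j j≤n))))

    aⱼ≡aᵢ+D : a j ≡ a i ℤ.+ + D
    aⱼ≡aᵢ+D = trans (split (a j) (a i)) (cong (ℤ._+_ (a i)) aⱼ-aᵢ≡D)
      where
      split : ∀ b c → b ≡ c ℤ.+ (b ℤ.- c)
      split = solve-∀

    ω[aᵢ+k]+dn≡j : ∀ k d → k + d * n ≡ D → to (a i ℤ.+ + k) ℤ.+ + (d * n) ≡ + j
    ω[aᵢ+k]+dn≡j k d k+dn≡D = begin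
      to (a i ℤ.+ + k) ℤ.+ + (d * n)     ≡⟨ to-+-multiple (a i ℤ.+ + k) d ⟨
      to (a i ℤ.+ + k ℤ.+ + (d * n))     ≡⟨ cong to (ℤP.+-assoc (a i) (+ k) (+ (d * n))) ⟩
      to (a i ℤ.+ + (k + d * n))         ≡⟨ cong (λ c → to (a i ℤ.+ + c)) k+dn≡D ⟩
      to (a i ℤ.+ + D)                   ≡⟨ cong to aⱼ≡aᵢ+D ⟨
      to (a j)                           ≡⟨ ω-a j ⟩
      + j                                ∎
      where open ≡-Reasoning

    ω[aᵢ+D+en]≡ : ∀ e → to (a i ℤ.+ + (D + e * n)) ≡ + j ℤ.+ + (e * n)
    ω[aᵢ+D+en]≡ e = begin
      to (a i ℤ.+ + (D + e * n))         ≡⟨ cong to (ℤP.+-assoc (a i) (+ D) (+ (e * n))) ⟨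
      to (a i ℤ.+ + D ℤ.+ + (e * n))     ≡⟨ cong (λ z → to (z ℤ.+ + (e * n))) aⱼ≡aᵢ+D ⟨
      to (a j ℤ.+ + (e * n))             ≡⟨ to-+-multiple (a j) e ⟩
      to (a j) ℤ.+ + (e * n)             ≡⟨ cong (ℤ._+ + (e * n)) (ω-a j) ⟩
      + j ℤ.+ + (e * n)                  ∎
      where open ≡-Reasoning

    ρ≢0 : ρ ≢ 0
    ρ≢0 ρ≡0 = distinct K i+Kn≡j
      where
      i+Kn≡j : i + K * n ≡ j
      i+Kn≡j = ℤP.+-injective (trans (cong (ℤ._+ + (K * n)) (sym ω[aᵢ+0]≡i))
                                     (ω[aᵢ+k]+dn≡j 0 K (trans (cong (_+ K * n) (sym ρ≡0)) (sym D≡ρ+Kn))))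
        where
        ω[aᵢ+0]≡i : to (a i ℤ.+ + 0) ≡ + i
        ω[aᵢ+0]≡i = trans (cong to (ℤP.+-identityʳ (a i))) (ω-a i)
      distinct : ∀ K → i + K * n ≢ j
      distinct zero    e = ℕP.<-irrefl (trans (sym (ℕP.+-identityʳ i)) e) i<j
      distinct (suc K) e = ℕP.<⇒≱ (ℕP.<-≤-trans (ℕP.m<n+m n 1≤i) (ℕP.+-monoʳ-≤ i (ℕP.m≤m+n n (K * n))))
                                  (subst (_≤ n) (sym e) j≤n)

    residue-ρ⇒≡ρ+qn : ∀ k → k % n ≡ ρ → k ≡ ρ + k / n * n
    residue-ρ⇒≡ρ+qn k k%n≡ρ = trans (m≡m%n+[m/n]*n k n) (cong (_+ k / n * n) k%n≡ρ)

    -- For k ≡ D (mod n), a i + k is a j shifted by the multiple k − D of n, and 1 ≤ j ≤ n.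
    below-or-above : ∀ k → k % n ≡ ρ →
      (k < D × to (a i ℤ.+ + k) ℤ.≤ + 0) ⊎ (D ≤ k × + 1 ℤ.≤ to (a i ℤ.+ + k))
    below-or-above k k%n≡ρ with k / n <? K
    ... | yes q<K = inj₁ (k<D , y+dn≡j⇒y≤0 n (K ∸ q) j _ (ℕP.m<n⇒0<n∸m q<K) j≤n (ω[aᵢ+k]+dn≡j k (K ∸ q) k+[K-q]n≡D))
      where
      q = k / n
      k≡ = residue-ρ⇒≡ρ+qn k k%n≡ρ
      k<D : k < D
      k<D = subst₂ _<_ (sym k≡) (sym D≡ρ+Kn) (Equivalence.from (offset-multiple-<⇔ n ρ q K) q<K)
      k+[K-q]n≡D : k + (K ∸ q) * n ≡ D
      k+[K-q]n≡D = trans (cong (_+ (K ∸ q) * n) k≡)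
                         (trans (offset-multiple-fill n ρ q K (ℕP.<⇒≤ q<K)) (sym D≡ρ+Kn))
    ... | no  q≮K = inj₂ (D≤k , 1≤ω[aᵢ+k])
      where
      q = k / n
      k≡D+[q-K]n : k ≡ D + (q ∸ K) * n
      k≡D+[q-K]n = trans (residue-ρ⇒≡ρ+qn k k%n≡ρ) (trans (sym (offset-multiple-fill n ρ K q (ℕP.≮⇒≥ q≮K)))
                         (cong (_+ (q ∸ K) * n) (sym D≡ρ+Kn)))
      D≤k : D ≤ k
      D≤k = subst (D ≤_) (sym k≡D+[q-K]n) (ℕP.m≤m+n D _)
      1≤ω[aᵢ+k] : + 1 ℤ.≤ to (a i ℤ.+ + k)
      1≤ω[aᵢ+k] = subst (+ 1 ℤ.≤_) (sym (trans (cong (λ c → to (a i ℤ.+ + c)) k≡D+[q-K]n) (ω[aᵢ+D+en]≡ (q ∸ K))))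
                        (ℤ.+≤+ (ℕP.≤-trans 1≤j (ℕP.m≤m+n j _)))

    open ResidueCount n ρ ρ<n

    orbit : ℕ → ℤ
    orbit k = a i ℤ.- a 1 ℤ.+ + k

    orbit+a₁ : ∀ k → orbit k ℤ.+ a 1 ≡ a i ℤ.+ + k
    orbit+a₁ k = regroup (a i) (a 1) (+ k)
      where
      regroup : ∀ b c k → b ℤ.- c ℤ.+ k ℤ.+ c ≡ b ℤ.+ k
      regroup = solve-∀

    inH-orbit : ∀ k → 1 ≤ k → k % n ≡ ρ → inH n p x (orbit k) ≡ does (k <? D)
    inH-orbit k 1≤k k%n≡ρ with below-or-above k k%n≡ρ
    ... | inj₁ (k<D , ω≤0) =
      trans (Equivalence.from (inH⇔ (orbit k)) (0<orbit , subst (λ z → to z ℤ.≤ + 0) (sym (orbit+a₁ k)) ω≤0))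
            (sym (dec-true (k <? D) k<D))
      where
      0<orbit : + 0 ℤ.< orbit k
      0<orbit = ℤP.+-mono-≤-< (ℤP.i≤j⇒0≤j-i (from1≤from i 1≤i i≤n)) (ℤ.+<+ 1≤k)
    ... | inj₂ (D≤k , 1≤ω) = trans (BoolP.¬-not excluded) (sym (dec-false (k <? D) (ℕP.≤⇒≯ D≤k)))
      where
      excluded : inH n p x (orbit k) ≢ true
      excluded inH≡true = ℤP.<⇒≱ (ℤ.+<+ (s≤s z≤n)) (ℤP.≤-trans 1≤ω
        (subst (λ z → to z ℤ.≤ + 0) (orbit+a₁ k) (proj₂ (Equivalence.to (inH⇔ (orbit k)) inH≡true))))

    codinv-test : ∀ k → 1 ≤ k →
      inH n p x (ellN n p x i ℤ.+ + k) ∧ does ((ellN n p x i ℤ.+ + k ℤ.- ellN n p x j) ℤ.%ℕ n ℕ.≟ 0)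
        ≡ does (k <? D) ∧ HasResidue k
    codinv-test k 1≤k = begin
      inH n p x (ellN n p x i ℤ.+ + k) ∧ does ((ellN n p x i ℤ.+ + k ℤ.- ellN n p x j) ℤ.%ℕ n ℕ.≟ 0)
        ≡⟨ cong₂ (λ u v → inH n p x (u ℤ.+ + k) ∧ does ((u ℤ.+ + k ℤ.- v) ℤ.%ℕ n ℕ.≟ 0))
                 (ellN≡ i 1≤i i≤n) (ellN≡ j 1≤j j≤n) ⟩
      inH n p x (orbit k) ∧ does ((orbit k ℤ.- (a j ℤ.- a 1)) ℤ.%ℕ n ℕ.≟ 0)
        ≡⟨ cong (λ z → inH n p x (orbit k) ∧ does (z ℤ.%ℕ n ℕ.≟ 0)) orbit-difference ⟩
      inH n p x (orbit k) ∧ does ((+ k ℤ.- + D) ℤ.%ℕ n ℕ.≟ 0)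
        ≡⟨ cong (inH n p x (orbit k) ∧_) (does-⇔ (difference-%ℕ≡0⇔ k D) ((+ k ℤ.- + D) ℤ.%ℕ n ℕ.≟ 0) (k % n ℕ.≟ ρ)) ⟩
      inH n p x (orbit k) ∧ HasResidue k
        ≡⟨ by-residue (k % n ℕ.≟ ρ) ⟩
      does (k <? D) ∧ HasResidue k  ∎
      where
      open ≡-Reasoning
      orbit-difference : orbit k ℤ.- (a j ℤ.- a 1) ≡ + k ℤ.- + D
      orbit-difference = trans (cong (λ z → orbit k ℤ.- (z ℤ.- a 1)) aⱼ≡aᵢ+D) (regroup (a i) (a 1) (+ k) (+ D))
        where
        regroup : ∀ b c k d → b ℤ.- c ℤ.+ k ℤ.- (b ℤ.+ d ℤ.- c) ≡ k ℤ.- d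
        regroup = solve-∀
      by-residue : (k%n≟ρ : Dec (k % n ≡ ρ)) → inH n p x (orbit k) ∧ does k%n≟ρ ≡ does (k <? D) ∧ does k%n≟ρ
      by-residue (yes k%n≡ρ) = cong (_∧ true) (inH-orbit k 1≤k k%n≡ρ)
      by-residue (no  _)     = trans (BoolP.∧-zeroʳ _) (sym (BoolP.∧-zeroʳ _))

    codinv≡countBelow : codinv n p x i j ≡ countBelow (λ k → does (k <? D) ∧ HasResidue k) p
    codinv≡countBelow = begin
      codinv n p x i j
        ≡⟨ cong (λ p′ → length (filter test? (map shift (drop 1 (upTo p′))))) (ℕP.suc-pred p) ⟨
      length (filter test? (map shift (applyUpTo suc (ℕ.pred p))))
        ≡⟨ cong (λ xs → length (filter test? xs)) (ListP.map-applyUpTo suc shift (ℕ.pred p)) ⟩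
      length (filter test? (applyUpTo (λ k → shift (suc k)) (ℕ.pred p)))
        ≡⟨ length-filter-applyUpTo test? (λ k → shift (suc k)) (ℕ.pred p) ⟩
      countBelow (λ k → does (test? (shift (suc k)))) (ℕ.pred p)
        ≡⟨ countBelow-cong _ _ (ℕ.pred p) (λ k _ → codinv-test (suc k) (s≤s z≤n)) ⟩
      countBelow (λ k → Q (suc k)) (ℕ.pred p)
        ≡⟨ cong (λ b → boolToℕ b + countBelow (λ k → Q (suc k)) (ℕ.pred p)) Q0≡false ⟨
      countBelow Q (suc (ℕ.pred p))
        ≡⟨ cong (countBelow Q) (ℕP.suc-pred p) ⟩
      countBelow Q p  ∎
      where
      open ≡-Reasoning
      test? = λ h → T? (inH n p x h ∧ does ((h ℤ.- ellN n p x j) ℤ.%ℕ n ℕ.≟ 0))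
      shift = λ (k : ℕ) → ellN n p x i ℤ.+ + k
      Q = λ k → does (k <? D) ∧ HasResidue k
      Q0≡false : Q 0 ≡ false
      Q0≡false = trans (cong (does (0 <? D) ∧_)
                   (dec-false (0 % n ℕ.≟ ρ) (λ 0≡ρ → ρ≢0 (trans (sym 0≡ρ) (m<n⇒m%n≡m (ℕ.>-nonZero⁻¹ n))))))
                 (BoolP.∧-zeroʳ _)

    uᵢ : ℕ
    uᵢ = (a i ℤ.- + 1) ℤ.%ℕ n

    cᵢ : ℤ
    cᵢ = (a i ℤ.- + 1) ℤ./ℕ n

    aⱼ-1≡uᵢ+ρ+[cᵢ+K]n : a j ℤ.- + 1 ≡ + (uᵢ + ρ) ℤ.+ (cᵢ ℤ.+ + K) ℤ.* + n
    aⱼ-1≡uᵢ+ρ+[cᵢ+K]n = begin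
      a j ℤ.- + 1
        ≡⟨ cong (λ z → z ℤ.- + 1) (trans aⱼ≡aᵢ+D (cong (λ d → a i ℤ.+ + d) D≡ρ+Kn)) ⟩
      a i ℤ.+ + (ρ + K * n) ℤ.- + 1                ≡⟨ cong (λ z → a i ℤ.+ (+ ρ ℤ.+ z) ℤ.- + 1) (ℤP.pos-* K n) ⟩
      a i ℤ.+ (+ ρ ℤ.+ + K ℤ.* + n) ℤ.- + 1        ≡⟨ regroup (a i) (+ ρ) (+ K) (+ n) ⟩
      (a i ℤ.- + 1) ℤ.+ + ρ ℤ.+ + K ℤ.* + n
        ≡⟨ cong (λ z → z ℤ.+ + ρ ℤ.+ + K ℤ.* + n) (a≡a%ℕn+[a/ℕn]*n (a i ℤ.- + 1) n) ⟩
      (+ uᵢ ℤ.+ cᵢ ℤ.* + n) ℤ.+ + ρ ℤ.+ + K ℤ.* + n ≡⟨ collect (+ uᵢ) cᵢ (+ ρ) (+ K) (+ n) ⟩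
      + (uᵢ + ρ) ℤ.+ (cᵢ ℤ.+ + K) ℤ.* + n          ∎
      where
      open ≡-Reasoning
      regroup : ∀ b ρ K n → b ℤ.+ (ρ ℤ.+ K ℤ.* n) ℤ.- + 1 ≡ (b ℤ.- + 1) ℤ.+ ρ ℤ.+ K ℤ.* n
      regroup = solve-∀
      collect : ∀ u c ρ K n → (u ℤ.+ c ℤ.* n) ℤ.+ ρ ℤ.+ K ℤ.* n ≡ (u ℤ.+ ρ) ℤ.+ (c ℤ.+ K) ℤ.* n
      collect = solve-∀

    shiCondition≡ : shiCondition n r (sPerm n p ω i) (sPerm n p ω j) ≡ does (r <? ρ)
    shiCondition≡ with uᵢ + ρ <? n
    ... | yes uᵢ+ρ<n = trans (cong (λ s → shiCondition n r (suc uᵢ) (suc s))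
                               (%ℕ-unique _ (uᵢ + ρ) (cᵢ ℤ.+ + K) uᵢ+ρ<n aⱼ-1≡uᵢ+ρ+[cᵢ+K]n))
                             (shiCondition-unwrapped n r uᵢ ρ)
    ... | no  uᵢ+ρ≮n = trans (cong (λ s → shiCondition n r (suc uᵢ) (suc s))
                               (%ℕ-unique _ w (cᵢ ℤ.+ + K ℤ.+ + 1) w<n aⱼ-1≡w+[cᵢ+K+1]n))
                             (shiCondition-wrapped n r uᵢ ρ w uᵢ+ρ≡n+w ρ<n)
      where
      w = uᵢ + ρ ∸ n
      uᵢ+ρ≡n+w : uᵢ + ρ ≡ n + w
      uᵢ+ρ≡n+w = sym (ℕP.m+[n∸m]≡n (ℕP.≮⇒≥ uᵢ+ρ≮n))
      w<n : w < n
      w<n = ℕP.+-cancelˡ-< n w n (subst (_< n + n) uᵢ+ρ≡n+w (ℕP.+-mono-< (n%ℕd<d (a i ℤ.- + 1) n) ρ<n))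
      aⱼ-1≡w+[cᵢ+K+1]n : a j ℤ.- + 1 ≡ + w ℤ.+ (cᵢ ℤ.+ + K ℤ.+ + 1) ℤ.* + n
      aⱼ-1≡w+[cᵢ+K+1]n = trans aⱼ-1≡uᵢ+ρ+[cᵢ+K]n
        (trans (cong (λ v → + v ℤ.+ (cᵢ ℤ.+ + K) ℤ.* + n) uᵢ+ρ≡n+w) (carry (+ n) (+ w) cᵢ (+ K)))
        where
        carry : ∀ n w c K → (n ℤ.+ w) ℤ.+ (c ℤ.+ K) ℤ.* n ≡ w ℤ.+ (c ℤ.+ K ℤ.+ + 1) ℤ.* n
        carry = solve-∀

    shiTableau≡ : shiTableau n p ω i j ≡ (if does (r <? ρ) then K ⊓ m else K ⊓ suc m)
    shiTableau≡ = cong₂ (λ b k → if b then k ⊓ m else k ⊓ suc m) shiCondition≡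
                        (cong (λ z → ℤ.∣ z ℤ./ℕ n ∣) aⱼ-aᵢ≡D)

    p≡r+mn : p ≡ r + m * n
    p≡r+mn = m≡m%n+[m/n]*n p n

    countBelow-residue-D : countBelow HasResidue D ≡ K
    countBelow-residue-D = begin
      countBelow HasResidue D              ≡⟨ cong (countBelow HasResidue) (trans D≡ρ+Kn (ℕP.+-comm ρ _)) ⟩
      countBelow HasResidue (K * n + ρ)    ≡⟨ countBelow-residue K ρ (ℕP.<⇒≤ ρ<n) ⟩
      K + boolToℕ (does (ρ <? ρ))          ≡⟨ cong (λ b → K + boolToℕ b) (dec-false (ρ <? ρ) (ℕP.<-irrefl refl)) ⟩
      K + 0                                ≡⟨ ℕP.+-identityʳ K ⟩
      K                                    ∎
      where open ≡-Reasoning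

    countBelow-residue-p : countBelow HasResidue p ≡ m + boolToℕ (does (ρ <? r))
    countBelow-residue-p = trans (cong (countBelow HasResidue) (trans p≡r+mn (ℕP.+-comm r _)))
                                 (countBelow-residue m r (ℕP.<⇒≤ (m%n<n p n)))

    K≤m⇒D≤p : K ≤ m → ρ ≤ r → D ≤ p
    K≤m⇒D≤p K≤m ρ≤r = subst₂ _≤_ (sym D≡ρ+Kn) (sym p≡r+mn) (ℕP.+-mono-≤ ρ≤r (ℕP.*-monoˡ-≤ n K≤m))

    ρ≡r⇒K≤m : ρ ≡ r → K ≤ m
    ρ≡r⇒K≤m ρ≡r with K ≤? m
    ... | yes K≤m = K≤m
    ... | no  K≰m = ⊥-elim (ℤP.<-asym (stable (a i))
                      (ℤP.≤-<-trans ω[aᵢ+p]≤0 (subst (+ 0 ℤ.<_) (sym (ω-a i)) (ℤ.+<+ 1≤i))))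
      where
      m<K = ℕP.≰⇒> K≰m
      p+[K-m]n≡D : p + (K ∸ m) * n ≡ D
      p+[K-m]n≡D = begin
        p + (K ∸ m) * n              ≡⟨ cong (_+ (K ∸ m) * n) p≡r+mn ⟩
        r + m * n + (K ∸ m) * n      ≡⟨ offset-multiple-fill n r m K (ℕP.<⇒≤ m<K) ⟩
        r + K * n                    ≡⟨ cong (_+ K * n) ρ≡r ⟨
        ρ + K * n                    ≡⟨ D≡ρ+Kn ⟨
        D                            ∎
        where open ≡-Reasoning
      ω[aᵢ+p]≤0 : to (a i ℤ.+ + p) ℤ.≤ + 0
      ω[aᵢ+p]≤0 = y+dn≡j⇒y≤0 n (K ∸ m) j _ (ℕP.m<n⇒0<n∸m m<K) j≤n (ω[aᵢ+k]+dn≡j p (K ∸ m) p+[K-m]n≡D)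

    shi-value≡countBelow : (if does (r <? ρ) then K ⊓ m else K ⊓ suc m) ≡ countBelow HasResidue (p ⊓ D)
    shi-value≡countBelow with D ≤? p
    ... | yes D≤p = trans (min≡K (r <? ρ))
                          (sym (trans (cong (countBelow HasResidue) (ℕP.m≥n⇒m⊓n≡n D≤p)) countBelow-residue-D))
      where
      K≤m : K ≤ m
      K≤m = /-mono-≤ D≤p ℕP.≤-refl
      min≡K : (r<?ρ : Dec (r < ρ)) → (if does r<?ρ then K ⊓ m else K ⊓ suc m) ≡ K
      min≡K (yes _) = ℕP.m≤n⇒m⊓n≡m K≤m
      min≡K (no  _) = ℕP.m≤n⇒m⊓n≡m (ℕP.m≤n⇒m≤1+n K≤m)
    ... | no  D≰p = trans (by-cases (ℕP.<-cmp r ρ))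
                          (sym (trans (cong (countBelow HasResidue) (ℕP.m≤n⇒m⊓n≡m (ℕP.<⇒≤ p<D))) countBelow-residue-p))
      where
      p<D = ℕP.≰⇒> D≰p
      m≤K : m ≤ K
      m≤K = /-mono-≤ (ℕP.<⇒≤ p<D) ℕP.≤-refl
      by-cases : Tri (r < ρ) (r ≡ ρ) (ρ < r) →
                 (if does (r <? ρ) then K ⊓ m else K ⊓ suc m) ≡ m + boolToℕ (does (ρ <? r))
      by-cases (tri< r<ρ _ _) rewrite dec-true (r <? ρ) r<ρ | dec-false (ρ <? r) (ℕP.<-asym r<ρ) =
        trans (ℕP.m≥n⇒m⊓n≡n m≤K) (sym (ℕP.+-identityʳ m))
      by-cases (tri≈ _ r≡ρ _) =
        ⊥-elim (ℕP.<⇒≱ p<D (K≤m⇒D≤p (ρ≡r⇒K≤m (sym r≡ρ)) (ℕP.≤-reflexive (sym r≡ρ))))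
      by-cases (tri> _ _ ρ<r) rewrite dec-false (r <? ρ) (ℕP.<-asym ρ<r) | dec-true (ρ <? r) ρ<r =
        trans (ℕP.m≥n⇒m⊓n≡n m<K) (ℕP.+-comm 1 m)
        where
        m<K : m < K
        m<K = ℕP.≰⇒> (λ K≤m → ℕP.<⇒≱ p<D (K≤m⇒D≤p K≤m (ℕP.<⇒≤ ρ<r)))

    shiTableau≡codinv : shiTableau n p ω i j ≡ codinv n p x i j
    shiTableau≡codinv = begin
      shiTableau n p ω i j                                  ≡⟨ shiTableau≡ ⟩
      (if does (r <? ρ) then K ⊓ m else K ⊓ suc m)          ≡⟨ shi-value≡countBelow ⟩
      countBelow HasResidue (p ⊓ D)                         ≡⟨ countBelow-∧-below HasResidue D p ⟨
      countBelow (λ k → does (k <? D) ∧ HasResidue k) p     ≡⟨ codinv≡countBelow ⟨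
      codinv n p x i j                                      ∎
      where open ≡-Reasoning

theorem3p2 : (n p : ℕ) → .{{_ : NonZero n}} → .{{_ : NonZero p}} → Coprime n p →
    (ω : ℤ ↔ ℤ) → IsAffinePerm n ω → Dominant n ω → PStable p ω →
    (x : List Step) → IsDyck n p x →
    (κ : List ℕ) → IsPartition κ → IsCore n p κ →
    (∀ z → InAlpha κ z ⇔ (Inverse.to ω z ℤ.≤ + 0)) →
    (∀ h → FirstColHook κ h ⇔ (inH n p x h ≡ true)) →
    ∀ i j → 1 ≤ i → i < j → j ≤ n →
    shiTableau n p ω i j ≡ codinv n p x i j
theorem3p2 n p coprime ω affine dominant stable x dyck κ partition _ α≡ H≡ i j 1≤i i<j j≤n =
  ShiTableauEqualsCodinv.Entry.shiTableau≡codinv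
    n p coprime ω affine dominant stable x dyck κ partition α≡ H≡ i j 1≤i i<j j≤n
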